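{- For every integer $n\ge 1$, let $k=\ell(n)+1$ where $\ell(n)$ is the length of $b(n)$, and let $G$ be the Dyck nest of length $2k$ obtained from $F(\rho(n))$ by repeated blowing. Then the clones $\sigma(G)=(\sigma_{k-1}(G),\ldots,\sigma_1(G))$ and $\sigma(F(n))=(\sigma_{k-1}(F(n)),\ldots,\sigma_1(F(n)))$ differ solely at the $\gamma(n)$-th entry: $\sigma_j(G)=\sigma_j(F(n))$ for all $j\in[1,k-1]\setminus\{\gamma(n)\}$, and $\sigma_{\gamma(n)}(G)\ne\sigma_{\gamma(n)}(F(n))$.
   Context: Dyck words and Dyck nests. A Dyck word of length $2k$ is a binary string with $k$ ones in which every prefix has at least as many 0s as 1s. Reading it left to right, 0 = up-step and 1 = down-step gives a lattice path from height 0. Its Dyck nest is the integer string obtained by labelling the steps with $1,2,\ldots,k$: process the horizontal unit layers $[y,y+1]$, $y=0,1,2,\dots$, in increasing order, and in each layer assign consecutive integers (continuing the count) to the up-steps from right to left and likewise to the down-steps from right to left. In a Dyck nest of length $2k$ the two entries equal to $k$ are adjacent. Clone. For a Dyck nest $H$ of length $2k$ and $j\in[1,k-1]$, let $p_j<r_j$ be the two positions of $H$ holding the value $j$, and set $\sigma_j(H)=\lfloor (r_j-p_j)/2\rfloor$. The clone of $H$ is $\sigma(H)=(\sigma_{k-1}(H),\ldots,\sigma_2(H),\sigma_1(H))$. Blowing. For a Dyck nest $H$ of length $2K$, $q(H)$ is obtained by inserting $(K+1)(K+1)$ between the two adjacent entries equal to $K$; repeated blowing of a nest of length $2K\le 2k$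 to length $2k$ means applying $q^{k-K}$. Tight restricted-growth strings (TRGS). A TRGS is a string $a_{L}\cdots a_1$ of nonnegative integers (positions counted from the right) such that either $L=1$ and $a_1\in\{0,1\}$, or $L\ge 2$, $a_L=1$ and $a_j\le a_{j+1}+1$ for $1\le j<L$. Order the TRGSs first by length and, within a length, lexicographically; let $b(0)=0,b(1)=1,b(2)=10,b(3)=11,b(4)=12,b(5)=100,\ldots$ be this enumeration. For $n\ge1$, $\gamma(n)$ is the position (from the right, rightmost $=1$) of the rightmost nonzero entry of $b(n)$. The parent $\rho(n)$ of $n\ge1$: if $\gamma(n)$ equals the length of $b(n)$ then $\rho(n)=0$; otherwise $b(\rho(n))$ is $b(n)$ with its entry at position $\gamma(n)$ decreased by $1$. Castling. For a Dyck nest $H$ and integer $\gamma\ge1$, write $H=W\,M\,Z$ with $|W|=\gamma-1$, $|Z|=\gamma$; let $x$ be the first entry of $M$ and split $M=X\,Y$ where $Y$ begins at the first entry of $M$ after its first entry that equals $x+1$; put $\mathrm{Cast}_\gamma(H)=W\,Y\,X\,Z$. The nests $F(n)$. $F(0)=11$; for $n\ge1$, with $k=\ell(n)+1$ and $G$ the blow of $F(\rho(n))$ to length $2k$, $F(n)=\mathrm{Cast}_{\gamma(n)}(G)$. -}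

module Defs where

open import Data.Nat using (ℕ; zero; suc; _+_; _∸_; _/_; _≡ᵇ_)
open import Data.Bool using (Bool; true; false; if_then_else_; _∧_)
open import Data.List using (List; []; _∷_; map; concat; length; reverse; take; drop; _++_; upTo)
open import Data.Product using (_×_; _,_)

nth : {A : Set} → ℕ → List A → A → A
nth i       []       d = d
nth zero    (x ∷ xs) d = x
nth (suc i) (x ∷ xs) d = nth i xs d

eqList : List ℕ → List ℕ → Bool
eqList []       []       = true
eqList (x ∷ xs) (y ∷ ys) = (x ≡ᵇ y) ∧ eqList xs ys
eqList _        _        = false

positionsFrom : ℕ → ℕ → List ℕ → List ℕ
positionsFrom i v []       = []
positionsFrom i v (x ∷ xs) =
  if x ≡ᵇ v then i ∷ positionsFrom (suc i) v xs else positionsFrom (suc i) v xs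

positions : ℕ → List ℕ → List ℕ
positions = positionsFrom 0

-- Tight restricted-growth strings, written a_L ... a_1 (a_L leftmost)

ext : ℕ → ℕ → List (List ℕ)
ext p zero    = [] ∷ []
ext p (suc m) = concat (map (λ v → map (v ∷_) (ext v m)) (upTo (suc (suc p))))

trgs : ℕ → List (List ℕ)
trgs zero          = []
trgs (suc zero)    = (0 ∷ []) ∷ (1 ∷ []) ∷ []
trgs (suc (suc m)) = map (1 ∷_) (ext 1 (suc m))

trgsUpTo : ℕ → List (List ℕ)
trgsUpTo zero    = []
trgsUpTo (suc L) = trgsUpTo L ++ trgs (suc L)

-- b n : the n-th TRGS (0-based).  Lengths 1..n+1 already contribute more
-- than n strings, so the default [] is never used.
b : ℕ → List ℕ
b n = nth n (trgsUpTo (suc n)) []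

ℓ : ℕ → ℕ
ℓ n = length (b n)

firstNonzero : List ℕ → ℕ
firstNonzero []            = 0
firstNonzero (zero  ∷ xs)  = suc (firstNonzero xs)
firstNonzero (suc _ ∷ xs)  = 1

-- γ n : position from the right (rightmost = 1) of the rightmost nonzero
-- entry of b n (list reversed so that a_1 comes first)
γ : ℕ → ℕ
γ n = firstNonzero (reverse (b n))

decAt : ℕ → List ℕ → List ℕ
decAt i       []       = []
decAt zero    (x ∷ xs) = x ∷ xs
decAt (suc zero) (x ∷ xs) = (x ∸ 1) ∷ xs
decAt (suc (suc i)) (x ∷ xs) = x ∷ decAt (suc i) xs

searchIndex : List ℕ → List ℕ → ℕ
searchIndex s []       = 0
searchIndex s (m ∷ ms) = if eqList (b m) s then m else searchIndex s ms

-- ρ n : parent of n.  Position γ from the right is position ℓ+1-γ from the left.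
-- The parent string is lexicographically smaller of the same length, so its
-- index lies among 0..n-1.
ρ : ℕ → ℕ
ρ n = if γ n ≡ᵇ ℓ n then 0
      else searchIndex (reverse (decAt (γ n) (reverse (b n)))) (upTo n)

σ : ℕ → List ℕ → ℕ
σ j H with positions j H
... | p ∷ r ∷ _ = (r ∸ p) / 2
... | _         = 0

clone : List ℕ → List ℕ
clone H = reverse (map (λ i → σ (suc i) H) (upTo (length H / 2 ∸ 1)))

insertAfterFirst : ℕ → List ℕ → List ℕ
insertAfterFirst v []       = []
insertAfterFirst v (x ∷ xs) =
  if x ≡ᵇ v then x ∷ suc v ∷ suc v ∷ xs else x ∷ insertAfterFirst v xs

-- blowing q(H), H of length 2K: insert (K+1)(K+1) between the two adjacent K's
blow : List ℕ → List ℕ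
blow H = insertAfterFirst (length H / 2) H

iter : {A : Set} → ℕ → (A → A) → A → A
iter zero    f x = x
iter (suc m) f x = f (iter m f x)

blowTo : ℕ → List ℕ → List ℕ
blowTo k H = iter (k ∸ length H / 2) blow H

splitIndex : ℕ → List ℕ → ℕ
splitIndex v []       = 0
splitIndex v (x ∷ xs) = suc (go xs)
  where
  go : List ℕ → ℕ
  go []       = 0
  go (y ∷ ys) = if y ≡ᵇ v then 0 else suc (go ys)

cast : ℕ → List ℕ → List ℕ
cast g H = W ++ Y ++ X ++ Z
  where
  W  = take (g ∸ 1) H
  R  = drop (g ∸ 1) H
  M  = take (length R ∸ g) R
  Z  = drop (length R ∸ g) R
  i  = splitIndex (suc (nth 0 M 0)) M
  X  = take i M
  Y  = drop i M

-- F with fuel; since ρ n < n for n ≥ 1, fuel n+1 suffices for F n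
Ffuel : ℕ → ℕ → List ℕ
Ffuel zero    n       = 1 ∷ 1 ∷ []
Ffuel (suc f) zero    = 1 ∷ 1 ∷ []
Ffuel (suc f) (suc n) =
  cast (γ (suc n)) (blowTo (ℓ (suc n) + 1) (Ffuel f (ρ (suc n))))

F : ℕ → List ℕ
F n = Ffuel (suc n) n

-- Read b n from the right as r = a₁ a₂ … a_L.  F n has the closed form
-- nest r, a row of labelled arches built from r, and prepending 0 to r just
-- encloses the nest in a new outermost arch.  If a_γ is the lowest nonzero
-- entry then r = 0^g (c + 1) r′ with γ = g + 1 and the parent string is
-- 0^g c r′, so G is the g-fold enclosure of nest (c ∷ r′), and castling at γ
-- acts on this core only, turning nest (c ∷ r′) = X Y 1 into
-- Y X 1 = nest (c + 1 ∷ r′).  Every label j ≥ 2 of the core occurs twice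
-- inside X or twice inside Y, so σ_j survives the swap, whereas the two 1s
-- move apart by |Y| ≥ 2.  Enclosing shifts labels by one without changing σ,
-- and the σ of the g enclosing arches depend only on the length of the core;
-- hence σ changes exactly at g + 1 = γ.

module Submission where

open import Defs
open import Data.Nat using (ℕ; zero; suc; _+_; _∸_; _≤_; _<_; _≡ᵇ_; z≤n; s≤s; _/_; _*_; s≤s⁻¹)
open import Data.Nat.Properties
open import Data.Nat.Divisibility using (divides)
open import Data.Nat.DivMod using (+-distrib-/-∣ʳ; m*n/n≡m; /-monoˡ-≤)
open import Data.Bool using (true; false; if_then_else_; T)
open import Data.List using (List; []; _∷_; map; concat; length; take; drop; _++_; replicate; reverse; upTo)
import Data.List.Properties as List
open import Data.Product using (_×_; _,_; ∃; proj₁; proj₂; map₁)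
open import Data.Sum using (_⊎_; inj₁; inj₂)
open import Data.Empty using (⊥; ⊥-elim)
open import Function using (id)
open import Data.Unit using (⊤; tt)
open import Relation.Binary.Definitions using (tri<; tri≈; tri>)
open import Relation.Binary.PropositionalEquality
open import Data.List.Relation.Unary.Any using (here; there)
open import Data.List.Membership.Propositional using (_∈_)
open import Data.List.Membership.Propositional.Properties
  using (∈-++⁺ˡ; ∈-++⁺ʳ; ∈-map⁺; ∈-concat⁺′; ∈-upTo⁺; ∈-upTo⁻)
open import Data.List.Relation.Unary.AllPairs as AllPairs using (AllPairs; []; _∷_)
import Data.List.Relation.Unary.AllPairs.Properties as AllPairs
open import Data.List.Relation.Unary.All as All using (All; []; _∷_)
import Data.List.Relation.Unary.All.Properties as All

≡ᵇ-refl : ∀ v → (v ≡ᵇ v) ≡ true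
≡ᵇ-refl zero    = refl
≡ᵇ-refl (suc v) = ≡ᵇ-refl v

≢⇒≡ᵇ-false : ∀ x v → x ≢ v → (x ≡ᵇ v) ≡ false
≢⇒≡ᵇ-false zero    zero    x≢v = ⊥-elim (x≢v refl)
≢⇒≡ᵇ-false zero    (suc v) x≢v = refl
≢⇒≡ᵇ-false (suc x) zero    x≢v = refl
≢⇒≡ᵇ-false (suc x) (suc v) x≢v = ≢⇒≡ᵇ-false x v (λ x≡v → x≢v (cong suc x≡v))

≡ᵇ-true⇒≡ : ∀ x v → (x ≡ᵇ v) ≡ true → x ≡ v
≡ᵇ-true⇒≡ x v e = ≡ᵇ⇒≡ x v (subst T (sym e) tt)

-- Occurrences and σ

count : ℕ → List ℕ → ℕ
count v []       = 0
count v (x ∷ xs) = if x ≡ᵇ v then suc (count v xs) else count v xs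

raise : List ℕ → List ℕ
raise = map suc

count-++ : ∀ v xs ys → count v (xs ++ ys) ≡ count v xs + count v ys
count-++ v []       ys = refl
count-++ v (x ∷ xs) ys with x ≡ᵇ v
... | true  = cong suc (count-++ v xs ys)
... | false = count-++ v xs ys

count-raise : ∀ v xs → count (suc v) (raise xs) ≡ count v xs
count-raise v []       = refl
count-raise v (x ∷ xs) with x ≡ᵇ v
... | true  = cong suc (count-raise v xs)
... | false = count-raise v xs

count-0-raise : ∀ xs → count 0 (raise xs) ≡ 0
count-0-raise []       = refl
count-0-raise (x ∷ xs) = count-0-raise xs

count-∷-≢ : ∀ v x xs → x ≢ v → count v (x ∷ xs) ≡ count v xs
count-∷-≢ v x xs x≢v rewrite ≢⇒≡ᵇ-false x v x≢v = refl

count-∷-≡ : ∀ v xs → count v (v ∷ xs) ≡ suc (count v xs)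
count-∷-≡ v xs rewrite ≡ᵇ-refl v = refl

count-absent : ∀ u k xs → All (k <_) xs → u ≤ k → count u xs ≡ 0
count-absent u k []       []         u≤k = refl
count-absent u k (x ∷ xs) (k<x ∷ ps) u≤k =
  trans (count-∷-≢ u x xs (λ x≡u → <⇒≢ (≤-<-trans u≤k k<x) (sym x≡u))) (count-absent u k xs ps u≤k)

count-concat-absent : ∀ u k Bs → All (All (k <_)) Bs → u ≤ k → count u (concat Bs) ≡ 0
count-concat-absent u k []       []       u≤k = refl
count-concat-absent u k (B ∷ Bs) (p ∷ ps) u≤k =
  trans (count-++ u B (concat Bs)) (cong₂ _+_ (count-absent u k B p u≤k) (count-concat-absent u k Bs ps u≤k))

positionsFrom-+ : ∀ d i v xs → positionsFrom (d + i) v xs ≡ map (d +_) (positionsFrom i v xs)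
positionsFrom-+ d i v []       = refl
positionsFrom-+ d i v (x ∷ xs) with x ≡ᵇ v | positionsFrom-+ d (suc i) v xs
... | true  | shifted rewrite +-suc d i = cong ((d + i) ∷_) shifted
... | false | shifted rewrite +-suc d i = shifted

positionsFrom-shift : ∀ d v xs → positionsFrom d v xs ≡ map (d +_) (positions v xs)
positionsFrom-shift d v xs = trans (cong (λ k → positionsFrom k v xs) (sym (+-identityʳ d))) (positionsFrom-+ d 0 v xs)

positionsFrom-++ : ∀ i v xs ys →
  positionsFrom i v (xs ++ ys) ≡ positionsFrom i v xs ++ positionsFrom (i + length xs) v ys
positionsFrom-++ i v []       ys = cong (λ k → positionsFrom k v ys) (sym (+-identityʳ i))
positionsFrom-++ i v (x ∷ xs) ys rewrite +-suc i (length xs) with x ≡ᵇ v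
... | true  = cong (i ∷_) (positionsFrom-++ (suc i) v xs ys)
... | false = positionsFrom-++ (suc i) v xs ys

positionsFrom-raise : ∀ i v xs → positionsFrom i (suc v) (raise xs) ≡ positionsFrom i v xs
positionsFrom-raise i v []       = refl
positionsFrom-raise i v (x ∷ xs) with x ≡ᵇ v
... | true  = cong (i ∷_) (positionsFrom-raise (suc i) v xs)
... | false = positionsFrom-raise (suc i) v xs

positionsFrom-absent : ∀ i v xs → count v xs ≡ 0 → positionsFrom i v xs ≡ []
positionsFrom-absent i v []       _ = refl
positionsFrom-absent i v (x ∷ xs) e with x ≡ᵇ v
positionsFrom-absent i v (x ∷ xs) () | true
... | false = positionsFrom-absent (suc i) v xs e

halfGap : List ℕ → ℕ
halfGap (p ∷ r ∷ _) = (r ∸ p) / 2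
halfGap _           = 0

σ-halfGap : ∀ j H → σ j H ≡ halfGap (positions j H)
σ-halfGap j H with positions j H
... | []        = refl
... | _ ∷ []    = refl
... | _ ∷ _ ∷ _ = refl

halfGap-shift : ∀ d ps → halfGap (map (d +_) ps) ≡ halfGap ps
halfGap-shift d []          = refl
halfGap-shift d (_ ∷ [])    = refl
halfGap-shift d (p ∷ r ∷ _) = cong (_/ 2) ([m+n]∸[m+o]≡n∸o d r p)

halfGap-++[] : ∀ ps → halfGap (ps ++ []) ≡ halfGap ps
halfGap-++[] ps = cong halfGap (List.++-identityʳ ps)

-- The two occurrences of j lie in the same block, so they move together.
σ-swap : ∀ j X Y Z → (count j Y ≡ 0 × count j Z ≡ 0) ⊎ (count j X ≡ 0 × count j Z ≡ 0) →
         σ j (X ++ Y ++ Z) ≡ σ j (Y ++ X ++ Z)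
σ-swap j X Y Z absent = begin
    σ j (X ++ Y ++ Z)
  ≡⟨ trans (σ-halfGap j (X ++ Y ++ Z)) (cong halfGap (split X Y)) ⟩
    halfGap (positions j X ++ positionsFrom (length X) j Y ++ positionsFrom (length X + length Y) j Z)
  ≡⟨ swapped absent ⟩
    halfGap (positions j Y ++ positionsFrom (length Y) j X ++ positionsFrom (length Y + length X) j Z)
  ≡⟨ sym (trans (σ-halfGap j (Y ++ X ++ Z)) (cong halfGap (split Y X))) ⟩
    σ j (Y ++ X ++ Z) ∎
  where
  open ≡-Reasoning
  split : ∀ U V → positions j (U ++ V ++ Z)
                ≡ positions j U ++ positionsFrom (length U) j V ++ positionsFrom (length U + length V) j Z
  split U V = trans (positionsFrom-++ 0 j U (V ++ Z)) (cong (positions j U ++_) (positionsFrom-++ (length U) j V Z))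
  swapped : (count j Y ≡ 0 × count j Z ≡ 0) ⊎ (count j X ≡ 0 × count j Z ≡ 0) →
    halfGap (positions j X ++ positionsFrom (length X) j Y ++ positionsFrom (length X + length Y) j Z)
    ≡ halfGap (positions j Y ++ positionsFrom (length Y) j X ++ positionsFrom (length Y + length X) j Z)
  swapped (inj₁ (y0 , z0))
    rewrite positionsFrom-absent 0 j Y y0 | positionsFrom-absent (length X) j Y y0
          | positionsFrom-absent (length X + length Y) j Z z0 | positionsFrom-absent (length Y + length X) j Z z0
          | positionsFrom-shift (length Y) j X
    = trans (halfGap-++[] (positions j X))
        (sym (trans (halfGap-++[] (map (length Y +_) (positions j X))) (halfGap-shift (length Y) (positions j X))))
  swapped (inj₂ (x0 , z0))
    rewrite positionsFrom-absent 0 j X x0 | positionsFrom-absent (length Y) j X x0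
          | positionsFrom-absent (length X + length Y) j Z z0 | positionsFrom-absent (length Y + length X) j Z z0
          | positionsFrom-shift (length X) j Y
    = trans (halfGap-++[] (map (length X +_) (positions j Y)))
        (trans (halfGap-shift (length X) (positions j Y)) (sym (halfGap-++[] (positions j Y))))

σ-between : ∀ v A B → count v A ≡ 0 → count v B ≡ 0 → σ v (A ++ v ∷ B ++ v ∷ []) ≡ suc (length B) / 2
σ-between v A B a0 b0 = begin
    σ v (A ++ v ∷ B ++ v ∷ [])
  ≡⟨ σ-halfGap v (A ++ v ∷ B ++ v ∷ []) ⟩
    halfGap (positions v (A ++ v ∷ B ++ v ∷ []))
  ≡⟨ cong halfGap (trans (positionsFrom-++ 0 v A (v ∷ B ++ v ∷ [])) (cong₂ _++_ (positionsFrom-absent 0 v A a0) tail)) ⟩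
    halfGap (length A ∷ suc (length A) + length B ∷ [])
  ≡⟨ cong (_/ 2) (trans (cong (_∸ length A) (sym (+-suc (length A) (length B)))) (m+n∸m≡n (length A) (suc (length B)))) ⟩
    suc (length B) / 2 ∎
  where
  open ≡-Reasoning
  tail : positionsFrom (length A) v (v ∷ B ++ v ∷ []) ≡ length A ∷ suc (length A) + length B ∷ []
  tail rewrite ≡ᵇ-refl v | positionsFrom-++ (suc (length A)) v B (v ∷ [])
             | positionsFrom-absent (suc (length A)) v B b0 | ≡ᵇ-refl v = refl

data Even : ℕ → Set where
  even-0  : Even 0
  even-ss : ∀ {n} → Even n → Even (suc (suc n))

even-+ : ∀ {a b} → Even a → Even b → Even (a + b)
even-+ even-0       eb = eb
even-+ (even-ss ea) eb = even-ss (even-+ ea eb)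

half-+-double : ∀ a t → (a + (t + t)) / 2 ≡ a / 2 + t
half-+-double a t = begin
    (a + (t + t)) / 2
  ≡⟨ cong (λ x → (a + x) / 2) (trans (cong (t +_) (sym (+-identityʳ t))) (*-comm 2 t)) ⟩
    (a + t * 2) / 2
  ≡⟨ +-distrib-/-∣ʳ a (divides t refl) ⟩
    a / 2 + t * 2 / 2
  ≡⟨ cong (a / 2 +_) (m*n/n≡m t 2) ⟩
    a / 2 + t ∎
  where open ≡-Reasoning

-- Arches, blocks and nests

arches : ℕ → List (List ℕ) → List ℕ
arches m []       = []
arches m (B ∷ Bs) = m ∷ B ++ m ∷ arches (m ∸ 1) Bs

-- nest r is a row of arches labelled m, m − 1, …, 1 around the blocks.
-- Prepending c raises the last c blocks and merges the first m − c arches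
-- into one new block, which the new last arch 1 encloses.
blocks : List ℕ → List (List ℕ)
blocks []      = [] ∷ []
blocks (c ∷ r) = map raise (drop (length (blocks r) ∸ c) (blocks r))
                 ++ raise (arches (length (blocks r)) (take (length (blocks r) ∸ c) (blocks r))) ∷ []

nest : List ℕ → List ℕ
nest r = arches (length (blocks r)) (blocks r)

headOr : ℕ → List ℕ → ℕ
headOr p []      = p
headOr p (x ∷ _) = x

arches-++ : ∀ m A B → arches m (A ++ B) ≡ arches m A ++ arches (m ∸ length A) B
arches-++ m []      B = refl
arches-++ m (a ∷ A) B = cong (m ∷_) (begin
    a ++ m ∷ arches (m ∸ 1) (A ++ B)
  ≡⟨ cong (λ z → a ++ m ∷ z) (arches-++ (m ∸ 1) A B) ⟩
    a ++ m ∷ arches (m ∸ 1) A ++ arches (m ∸ 1 ∸ length A) B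
  ≡⟨ cong (λ z → a ++ m ∷ arches (m ∸ 1) A ++ arches z B) (∸-+-assoc m 1 (length A)) ⟩
    a ++ m ∷ arches (m ∸ 1) A ++ arches (m ∸ suc (length A)) B
  ≡⟨ sym (List.++-assoc a (m ∷ arches (m ∸ 1) A) _) ⟩
    (a ++ m ∷ arches (m ∸ 1) A) ++ arches (m ∸ suc (length A)) B ∎)
  where open ≡-Reasoning

raise-arches : ∀ m Bs → length Bs ≤ m → raise (arches m Bs) ≡ arches (suc m) (map raise Bs)
raise-arches m       []       _         = refl
raise-arches (suc m) (B ∷ Bs) (s≤s len≤) = cong (suc (suc m) ∷_)
  (trans (List.map-++ suc B (suc m ∷ arches m Bs)) (cong (λ z → raise B ++ suc (suc m) ∷ z) (raise-arches m Bs len≤)))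

count-arches-outside : ∀ u m Bs → length Bs ≤ m → (u ≤ m ∸ length Bs ⊎ m < u) →
                       count u (arches m Bs) ≡ count u (concat Bs)
count-arches-outside u m       []       _         _       = refl
count-arches-outside u (suc m) (B ∷ Bs) (s≤s len≤) outside = begin
    count u (suc m ∷ B ++ suc m ∷ arches m Bs)
  ≡⟨ count-∷-≢ u (suc m) (B ++ suc m ∷ arches m Bs) (label≢u outside) ⟩
    count u (B ++ suc m ∷ arches m Bs)
  ≡⟨ count-++ u B _ ⟩
    count u B + count u (suc m ∷ arches m Bs)
  ≡⟨ cong (count u B +_) (trans (count-∷-≢ u (suc m) (arches m Bs) (label≢u outside))
                                 (count-arches-outside u m Bs len≤ (outside′ outside))) ⟩
    count u B + count u (concat Bs)
  ≡⟨ sym (count-++ u B (concat Bs)) ⟩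
    count u (concat (B ∷ Bs)) ∎
  where
  open ≡-Reasoning
  label≢u : u ≤ m ∸ length Bs ⊎ suc m < u → suc m ≢ u
  label≢u (inj₁ u≤)  e = <⇒≢ (s≤s (≤-trans u≤ (m∸n≤m m (length Bs)))) (sym e)
  label≢u (inj₂ m<u)   = <⇒≢ m<u
  outside′ : u ≤ m ∸ length Bs ⊎ suc m < u → u ≤ m ∸ length Bs ⊎ m < u
  outside′ (inj₁ u≤)  = inj₁ u≤
  outside′ (inj₂ m<u) = inj₂ (<-trans (n<1+n m) m<u)

All-arches : ∀ (P : ℕ → Set) m Bs → length Bs ≤ m → (∀ i → m ∸ length Bs < i → i ≤ m → P i) →
             All (All P) Bs → All P (arches m Bs)
All-arches P m       []       _         _      _          = []
All-arches P (suc m) (B ∷ Bs) (s≤s len≤) labels (pB ∷ pBs) =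
  label ∷ All.++⁺ pB (label ∷ All-arches P m Bs len≤ (λ i lo hi → labels i lo (m≤n⇒m≤1+n hi)) pBs)
  where label = labels (suc m) (s≤s (m∸n≤m m (length Bs))) ≤-refl

even-count-arches : ∀ u m Bs → All (λ B → ∀ u → Even (count u B)) Bs → Even (count u (arches m Bs))
even-count-arches u m []       _        = even-0
even-count-arches u m (B ∷ Bs) (e ∷ es) rewrite count-++ u B (m ∷ arches (m ∸ 1) Bs) with m ≡ᵇ u
... | true  rewrite +-suc (count u B) (count u (arches (m ∸ 1) Bs)) = even-ss (even-+ (e u) (even-count-arches u (m ∸ 1) Bs es))
... | false = even-+ (e u) (even-count-arches u (m ∸ 1) Bs es)

even-count-raise : ∀ B → (∀ u → Even (count u B)) → ∀ u → Even (count u (raise B))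
even-count-raise B e zero    = subst Even (sym (count-0-raise B)) even-0
even-count-raise B e (suc u) = subst Even (sym (count-raise u B)) (e u)

length-take-≤ : ∀ n (xs : List (List ℕ)) → n ≤ length xs → length (take n xs) ≡ n
length-take-≤ n xs n≤ = trans (List.length-take n xs) (m≤n⇒m⊓n≡m n≤)

length-drop-∸ : ∀ c (xs : List (List ℕ)) → c ≤ length xs → length (drop (length xs ∸ c) xs) ≡ c
length-drop-∸ c xs c≤ = trans (List.length-drop (length xs ∸ c) xs) (m∸[m∸n]≡n c≤)

length-blocks-∷ : ∀ c r → c ≤ length (blocks r) → length (blocks (c ∷ r)) ≡ suc c
length-blocks-∷ c r c≤ = begin
    length (map raise D ++ _ ∷ [])
  ≡⟨ List.length-++ (map raise D) ⟩
    length (map raise D) + 1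
  ≡⟨ cong (_+ 1) (trans (List.length-map raise D) (length-drop-∸ c (blocks r) c≤)) ⟩
    c + 1
  ≡⟨ +-comm c 1 ⟩
    suc c ∎
  where
  open ≡-Reasoning
  D = drop (length (blocks r) ∸ c) (blocks r)

nest-∷ : ∀ c r → c ≤ length (blocks r) →
  nest (c ∷ r) ≡ raise (arches c (drop (length (blocks r) ∸ c) (blocks r))) ++ 1 ∷
                 raise (arches (length (blocks r)) (take (length (blocks r) ∸ c) (blocks r))) ++ 1 ∷ []
nest-∷ c r c≤ = begin
    arches (length (blocks (c ∷ r))) (blocks (c ∷ r))
  ≡⟨ cong (λ z → arches z (blocks (c ∷ r))) (length-blocks-∷ c r c≤) ⟩
    arches (suc c) (map raise D ++ raise (arches m Ts) ∷ [])
  ≡⟨ arches-++ (suc c) (map raise D) _ ⟩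
    arches (suc c) (map raise D) ++ arches (suc c ∸ length (map raise D)) (raise (arches m Ts) ∷ [])
  ≡⟨ cong₂ _++_ (sym (raise-arches c D (≤-reflexive lenD)))
       (cong (λ z → arches (suc c ∸ z) (raise (arches m Ts) ∷ [])) (trans (List.length-map raise D) lenD)) ⟩
    raise (arches c D) ++ arches (suc c ∸ c) (raise (arches m Ts) ∷ [])
  ≡⟨ cong (λ z → raise (arches c D) ++ arches z (raise (arches m Ts) ∷ [])) (m+n∸n≡m 1 c) ⟩
    raise (arches c D) ++ 1 ∷ raise (arches m Ts) ++ 1 ∷ [] ∎
  where
  open ≡-Reasoning
  m = length (blocks r)
  D = drop (m ∸ c) (blocks r)
  Ts = take (m ∸ c) (blocks r)
  lenD : length D ≡ c
  lenD = length-drop-∸ c (blocks r) c≤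

nest-split : ∀ c r → c ≤ length (blocks r) →
  nest r ≡ arches (length (blocks r)) (take (length (blocks r) ∸ c) (blocks r))
           ++ arches c (drop (length (blocks r) ∸ c) (blocks r))
nest-split c r c≤ = begin
    arches m (blocks r)
  ≡⟨ cong (arches m) (sym (List.take++drop≡id (m ∸ c) (blocks r))) ⟩
    arches m (take (m ∸ c) (blocks r) ++ drop (m ∸ c) (blocks r))
  ≡⟨ arches-++ m (take (m ∸ c) (blocks r)) _ ⟩
    arches m (take (m ∸ c) (blocks r)) ++ arches (m ∸ length (take (m ∸ c) (blocks r))) (drop (m ∸ c) (blocks r))
  ≡⟨ cong (λ z → arches m (take (m ∸ c) (blocks r)) ++ arches z (drop (m ∸ c) (blocks r)))
       (trans (cong (m ∸_) (length-take-≤ (m ∸ c) (blocks r) (m∸n≤m m c))) (m∸[m∸n]≡n c≤)) ⟩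
    arches m (take (m ∸ c) (blocks r)) ++ arches c (drop (m ∸ c) (blocks r)) ∎
  where
  open ≡-Reasoning
  m = length (blocks r)

record Invariant (r : List ℕ) : Set where
  field
    length-blocks : length (blocks r) ≡ suc (headOr 0 r)
    blocks-above  : All (All (length (blocks r) <_)) (blocks r)
    blocks-even   : All (λ B → ∀ u → Even (count u B)) (blocks r)
    count-nest≤2  : ∀ u → count u (nest r) ≤ 2

invariant-[] : Invariant []
invariant-[] = record
  { length-blocks = refl
  ; blocks-above  = [] ∷ []
  ; blocks-even   = (λ _ → even-0) ∷ []
  ; count-nest≤2  = count≤2
  }
  where
  count≤2 : ∀ u → count u (1 ∷ 1 ∷ []) ≤ 2
  count≤2 zero          = z≤n
  count≤2 (suc zero)    = ≤-refl
  count≤2 (suc (suc u)) = z≤n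

count-arches-0 : ∀ L k Bs → length Bs ≤ L → All (All (k <_)) Bs → count 0 (arches L Bs) ≡ 0
count-arches-0 L k Bs len≤ above =
  trans (count-arches-outside 0 L Bs len≤ (inj₁ z≤n)) (count-concat-absent 0 k Bs above z≤n)

count-0-nest : ∀ r → Invariant r → count 0 (nest r) ≡ 0
count-0-nest r inv = count-arches-0 (length (blocks r)) (length (blocks r)) (blocks r) ≤-refl (Invariant.blocks-above inv)

module _ (A₁ A₂ : List ℕ) where

  count-0-raised-pair : count 0 (raise A₁ ++ 1 ∷ raise A₂ ++ 1 ∷ []) ≡ 0
  count-0-raised-pair rewrite count-++ 0 (raise A₁) (1 ∷ raise A₂ ++ 1 ∷ [])
    | count-++ 0 (raise A₂) (1 ∷ []) | count-0-raise A₁ | count-0-raise A₂ = refl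

  count-1-raised-pair : count 0 A₁ ≡ 0 → count 0 A₂ ≡ 0 → count 1 (raise A₁ ++ 1 ∷ raise A₂ ++ 1 ∷ []) ≡ 2
  count-1-raised-pair e₁ e₂ rewrite count-++ 1 (raise A₁) (1 ∷ raise A₂ ++ 1 ∷ [])
    | count-++ 1 (raise A₂) (1 ∷ []) | count-raise 0 A₁ | count-raise 0 A₂ | e₁ | e₂ = refl

  count-ss-raised-pair : ∀ u → count (suc (suc u)) (raise A₁ ++ 1 ∷ raise A₂ ++ 1 ∷ [])
                               ≡ count (suc u) A₁ + count (suc u) A₂
  count-ss-raised-pair u rewrite count-++ (suc (suc u)) (raise A₁) (1 ∷ raise A₂ ++ 1 ∷ [])
    | count-++ (suc (suc u)) (raise A₂) (1 ∷ []) | count-raise (suc u) A₁ | count-raise (suc u) A₂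
    | +-identityʳ (count (suc u) A₂) = refl

count-nest-∷≤2 : ∀ c r → Invariant r → c ≤ length (blocks r) → ∀ u → count u (nest (c ∷ r)) ≤ 2
count-nest-∷≤2 c r inv c≤m u rewrite nest-∷ c r c≤m = pair u
  where
  open Invariant inv
  m = length (blocks r)
  D = drop (m ∸ c) (blocks r)
  Ts = take (m ∸ c) (blocks r)
  pair : ∀ u → count u (raise (arches c D) ++ 1 ∷ raise (arches m Ts) ++ 1 ∷ []) ≤ 2
  pair zero rewrite count-0-raised-pair (arches c D) (arches m Ts) = z≤n
  pair (suc zero) rewrite count-1-raised-pair (arches c D) (arches m Ts)
      (count-arches-0 c m D (≤-reflexive (length-drop-∸ c (blocks r) c≤m)) (All.drop⁺ (m ∸ c) blocks-above))
      (count-arches-0 m m Ts (≤-trans (≤-reflexive (length-take-≤ (m ∸ c) (blocks r) (m∸n≤m m c))) (m∸n≤m m c))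
                      (All.take⁺ (m ∸ c) blocks-above)) = ≤-refl
  pair (suc (suc w)) rewrite count-ss-raised-pair (arches c D) (arches m Ts) w = subst (_≤ 2) (begin
      count (suc w) (nest r)
    ≡⟨ cong (count (suc w)) (nest-split c r c≤m) ⟩
      count (suc w) (arches m Ts ++ arches c D)
    ≡⟨ count-++ (suc w) (arches m Ts) (arches c D) ⟩
      count (suc w) (arches m Ts) + count (suc w) (arches c D)
    ≡⟨ +-comm (count (suc w) (arches m Ts)) _ ⟩
      count (suc w) (arches c D) + count (suc w) (arches m Ts) ∎) (count-nest≤2 (suc w))
    where open ≡-Reasoning

invariant-∷ : ∀ c r → Invariant r → c ≤ suc (headOr 0 r) → Invariant (c ∷ r)
invariant-∷ c r inv c≤ = record
  { length-blocks = length-blocks-∷ c r c≤m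
  ; blocks-above  = above
  ; blocks-even   = even
  ; count-nest≤2  = count-nest-∷≤2 c r inv c≤m
  }
  where
  open Invariant inv
  m = length (blocks r)
  c≤m : c ≤ m
  c≤m = subst (c ≤_) (sym length-blocks) c≤
  Ts = take (m ∸ c) (blocks r)
  lenTs : length Ts ≡ m ∸ c
  lenTs = length-take-≤ (m ∸ c) (blocks r) (m∸n≤m m c)
  c<merged : All (c <_) (arches m Ts)
  c<merged = All-arches (c <_) m Ts (≤-trans (≤-reflexive lenTs) (m∸n≤m m c))
    (λ i lo _ → subst (_< i) (trans (cong (m ∸_) lenTs) (m∸[m∸n]≡n c≤m)) lo)
    (All.map (All.map (≤-<-trans c≤m)) (All.take⁺ (m ∸ c) blocks-above))
  above : All (All (length (blocks (c ∷ r)) <_)) (blocks (c ∷ r))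
  above rewrite length-blocks-∷ c r c≤m = All.++⁺
    (All.map⁺ (All.map (λ aB → All.map⁺ (All.map (λ m<x → s≤s (≤-<-trans c≤m m<x)) aB))
                       (All.drop⁺ (m ∸ c) blocks-above)))
    (All.map⁺ (All.map s≤s c<merged) ∷ [])
  even : All (λ B → ∀ u → Even (count u B)) (blocks (c ∷ r))
  even = All.++⁺ (All.map⁺ (All.map (λ {B} → even-count-raise B) (All.drop⁺ (m ∸ c) blocks-even)))
    (even-count-raise (arches m Ts) (λ u → even-count-arches u m Ts (All.take⁺ (m ∸ c) blocks-even)) ∷ [])

-- Castling a nest

splitIndex-first : ∀ v x U V → count v U ≡ 0 → splitIndex v (x ∷ U ++ v ∷ V) ≡ suc (length U)
splitIndex-first v x []      V _ = cong (λ b → suc (if b then 0 else splitIndex v (x ∷ V))) (≡ᵇ-refl v)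
splitIndex-first v x (u ∷ U) V absent =
  trans (cong (λ b → suc (if b then 0 else splitIndex v (x ∷ U ++ v ∷ V))) (≢⇒≡ᵇ-false u v u≢v))
        (cong suc (splitIndex-first v x U V (trans (sym (count-∷-≢ v u U u≢v)) absent)))
  where
  u≢v : u ≢ v
  u≢v refl = 1+n≢0 (trans (sym (count-∷-≡ v U)) absent)

castSplit : List ℕ → ℕ
castSplit M = splitIndex (suc (nth 0 M 0)) M

cast-pieces : ∀ g H W R M Z → W ≡ take (g ∸ 1) H → R ≡ drop (g ∸ 1) H → M ≡ take (length R ∸ g) R →
              Z ≡ drop (length R ∸ g) R → cast g H ≡ W ++ drop (castSplit M) M ++ take (castSplit M) M ++ Z
cast-pieces g H _ _ _ _ refl refl refl refl = refl

take-++-≤ : ∀ n (xs ys : List ℕ) → n ≤ length xs → take n (xs ++ ys) ≡ take n xs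
take-++-≤ zero    xs       ys _         = refl
take-++-≤ (suc n) (x ∷ xs) ys (s≤s n≤) = cong (x ∷_) (take-++-≤ n xs ys n≤)

drop-++-≤ : ∀ n (xs ys : List ℕ) → n ≤ length xs → drop n (xs ++ ys) ≡ drop n xs ++ ys
drop-++-≤ zero    xs       ys _         = refl
drop-++-≤ (suc n) (x ∷ xs) ys (s≤s n≤) = drop-++-≤ n xs ys n≤

take-length-++ : ∀ (xs ys : List ℕ) → take (length xs) (xs ++ ys) ≡ xs
take-length-++ xs ys = trans (take-++-≤ (length xs) xs ys ≤-refl) (List.take-all (length xs) xs ≤-refl)

drop-length-++ : ∀ (xs ys : List ℕ) → drop (length xs) (xs ++ ys) ≡ ys
drop-length-++ xs ys = trans (drop-++-≤ (length xs) xs ys ≤-refl) (cong (_++ ys) (List.drop-all (length xs) xs ≤-refl))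

cast₁-swap : ∀ X Y z → castSplit (X ++ Y) ≡ length X → cast 1 (X ++ Y ++ z ∷ []) ≡ Y ++ X ++ z ∷ []
cast₁-swap X Y z split≡ = trans (cast-pieces 1 H [] H (X ++ Y) (z ∷ []) refl refl M≡ Z≡)
  (cong₂ _++_ (trans (cong (λ i → drop i (X ++ Y)) split≡) (drop-length-++ X Y))
              (cong (_++ z ∷ []) (trans (cong (λ i → take i (X ++ Y)) split≡) (take-length-++ X Y))))
  where
  H = X ++ Y ++ z ∷ []
  H≡ : H ≡ (X ++ Y) ++ z ∷ []
  H≡ = sym (List.++-assoc X Y (z ∷ []))
  length-H∸1 : length ((X ++ Y) ++ z ∷ []) ∸ 1 ≡ length (X ++ Y)
  length-H∸1 = trans (cong (_∸ 1) (List.length-++ (X ++ Y))) (m+n∸n≡m (length (X ++ Y)) 1)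
  M≡ : X ++ Y ≡ take (length H ∸ 1) H
  M≡ rewrite H≡ | length-H∸1 = sym (take-length-++ (X ++ Y) (z ∷ []))
  Z≡ : z ∷ [] ≡ drop (length H ∸ 1) H
  Z≡ rewrite H≡ | length-H∸1 = sym (drop-length-++ (X ++ Y) (z ∷ []))

drop-∷-take-∷ʳ : ∀ n (xs : List (List ℕ)) → n < length xs →
  ∃ λ y → drop n xs ≡ y ∷ drop (suc n) xs × take (suc n) xs ≡ take n xs ++ y ∷ []
drop-∷-take-∷ʳ zero    (x ∷ xs) _         = x , refl , refl
drop-∷-take-∷ʳ (suc n) (x ∷ xs) (s≤s n<) with drop-∷-take-∷ʳ n xs n<
... | y , d≡ , t≡ = y , d≡ , cong (x ∷_) t≡

All-drop-head : ∀ {P : List ℕ → Set} n xs {y ys} → drop n xs ≡ y ∷ ys → All P xs → P y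
All-drop-head n xs d≡ all = All.head (subst (All _) d≡ (All.drop⁺ n all))

even≤2-absorbs : ∀ {a p q} → Even a → p + (a + q) ≤ 2 → a ≡ 0 ⊎ q + p ≡ 0
even≤2-absorbs even-0 _ = inj₁ refl
even≤2-absorbs {suc (suc a)} {p} {q} (even-ss _) ≤2 = inj₂ (trans (+-comm q p) (n≤0⇒n≡0 p+q≤0))
  where
  p+q≤0 : p + q ≤ 0
  p+q≤0 = ≤-trans (+-monoʳ-≤ p (m≤n+m q a))
    (s≤s⁻¹ (s≤s⁻¹ (subst (_≤ 2) (trans (+-suc p (suc (a + q))) (cong suc (+-suc p (a + q)))) ≤2)))

-- nest (c ∷ r) = X Y 1 and nest (c + 1 ∷ r) = Y X 1, where Y is the arch
-- around the block of r that c + 1, unlike c, keeps out of the merged arch.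
module Castling (r : List ℕ) (inv : Invariant r) (c : ℕ) (c<m : suc c ≤ length (blocks r)) where
  open Invariant inv
  m = length (blocks r)
  k = m ∸ suc c

  m∸c≡1+k : m ∸ c ≡ suc k
  m∸c≡1+k = +-∸-assoc 1 c<m

  k<m : k < m
  k<m = subst (_≤ m) m∸c≡1+k (m∸n≤m m c)

  B* = proj₁ (drop-∷-take-∷ʳ k (blocks r) k<m)
  D = drop (suc k) (blocks r)
  Bs< = take k (blocks r)

  drop-k : drop k (blocks r) ≡ B* ∷ D
  drop-k = proj₁ (proj₂ (drop-∷-take-∷ʳ k (blocks r) k<m))

  take-1+k : take (suc k) (blocks r) ≡ Bs< ++ B* ∷ []
  take-1+k = proj₂ (proj₂ (drop-∷-take-∷ʳ k (blocks r) k<m))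

  length-Bs< : length Bs< ≡ k
  length-Bs< = length-take-≤ k (blocks r) (<⇒≤ k<m)

  m∸length-Bs< : m ∸ length Bs< ≡ suc c
  m∸length-Bs< = trans (cong (m ∸_) length-Bs<) (m∸[m∸n]≡n c<m)

  length-D : length D ≡ c
  length-D = trans (cong (λ z → length (drop z (blocks r))) (sym m∸c≡1+k)) (length-drop-∸ c (blocks r) (<⇒≤ c<m))

  A₁ = arches c D
  A₂ = arches m Bs<
  A* = arches (suc c) (B* ∷ [])
  X = raise A₁ ++ 1 ∷ raise A₂
  Y = raise A*

  nest-c : nest (c ∷ r) ≡ X ++ Y ++ 1 ∷ []
  nest-c = begin
      nest (c ∷ r)
    ≡⟨ nest-∷ c r (<⇒≤ c<m) ⟩
      raise (arches c (drop (m ∸ c) (blocks r))) ++ 1 ∷ raise (arches m (take (m ∸ c) (blocks r))) ++ 1 ∷ []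
    ≡⟨ cong (λ z → raise (arches c (drop z (blocks r))) ++ 1 ∷ raise (arches m (take z (blocks r))) ++ 1 ∷ [])
            m∸c≡1+k ⟩
      raise A₁ ++ 1 ∷ raise (arches m (take (suc k) (blocks r))) ++ 1 ∷ []
    ≡⟨ cong (λ z → raise A₁ ++ 1 ∷ raise z ++ 1 ∷ [])
         (trans (cong (arches m) take-1+k)
                (trans (arches-++ m Bs< (B* ∷ [])) (cong (λ z → A₂ ++ arches z (B* ∷ [])) m∸length-Bs<))) ⟩
      raise A₁ ++ 1 ∷ raise (A₂ ++ A*) ++ 1 ∷ []
    ≡⟨ cong (λ z → raise A₁ ++ 1 ∷ z ++ 1 ∷ []) (List.map-++ suc A₂ A*) ⟩
      raise A₁ ++ 1 ∷ (raise A₂ ++ Y) ++ 1 ∷ []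
    ≡⟨ cong (λ z → raise A₁ ++ 1 ∷ z) (List.++-assoc (raise A₂) Y (1 ∷ [])) ⟩
      raise A₁ ++ (1 ∷ raise A₂) ++ Y ++ 1 ∷ []
    ≡⟨ sym (List.++-assoc (raise A₁) (1 ∷ raise A₂) (Y ++ 1 ∷ [])) ⟩
      X ++ Y ++ 1 ∷ [] ∎
    where open ≡-Reasoning

  nest-1+c : nest (suc c ∷ r) ≡ Y ++ X ++ 1 ∷ []
  nest-1+c = begin
      nest (suc c ∷ r)
    ≡⟨ nest-∷ (suc c) r c<m ⟩
      raise (arches (suc c) (drop k (blocks r))) ++ 1 ∷ raise A₂ ++ 1 ∷ []
    ≡⟨ cong (λ z → raise (arches (suc c) z) ++ 1 ∷ raise A₂ ++ 1 ∷ []) drop-k ⟩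
      raise (arches (suc c) (B* ∷ D)) ++ 1 ∷ raise A₂ ++ 1 ∷ []
    ≡⟨ cong (λ z → raise z ++ 1 ∷ raise A₂ ++ 1 ∷ []) (arches-++ (suc c) (B* ∷ []) D) ⟩
      raise (A* ++ A₁) ++ 1 ∷ raise A₂ ++ 1 ∷ []
    ≡⟨ cong (_++ 1 ∷ raise A₂ ++ 1 ∷ []) (List.map-++ suc A* A₁) ⟩
      (Y ++ raise A₁) ++ 1 ∷ raise A₂ ++ 1 ∷ []
    ≡⟨ List.++-assoc Y (raise A₁) _ ⟩
      Y ++ raise A₁ ++ 1 ∷ raise A₂ ++ 1 ∷ []
    ≡⟨ cong (Y ++_) (sym (List.++-assoc (raise A₁) (1 ∷ raise A₂) (1 ∷ []))) ⟩
      Y ++ X ++ 1 ∷ [] ∎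
    where open ≡-Reasoning

  D-above : All (All (m <_)) D
  D-above = All.drop⁺ (suc k) blocks-above

  Bs<-above : All (All (m <_)) Bs<
  Bs<-above = All.take⁺ k blocks-above

  B*-above : All (m <_) B*
  B*-above = All-drop-head k (blocks r) drop-k blocks-above

  length-D≤ : length D ≤ c
  length-D≤ = ≤-reflexive length-D

  length-Bs<≤ : length Bs< ≤ m
  length-Bs<≤ = ≤-trans (≤-reflexive length-Bs<) (<⇒≤ k<m)

  count-0-A₁ : count 0 A₁ ≡ 0
  count-0-A₁ = count-arches-0 c m D length-D≤ D-above

  count-0-A₂ : count 0 A₂ ≡ 0
  count-0-A₂ = count-arches-0 m m Bs< length-Bs<≤ Bs<-above

  count-0-A* : count 0 A* ≡ 0
  count-0-A* = count-arches-0 (suc c) m (B* ∷ []) (s≤s z≤n) (B*-above ∷ [])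

  count-X : ∀ u → count (suc (suc u)) X ≡ count (suc u) A₁ + count (suc u) A₂
  count-X u = trans (count-++ (suc (suc u)) (raise A₁) (1 ∷ raise A₂))
                    (cong₂ _+_ (count-raise (suc u) A₁) (count-raise (suc u) A₂))

  X-head : ∃ λ X′ → X ≡ suc c ∷ X′
  X-head with D | length-D
  ... | []    | refl = raise A₂ , refl
  ... | _ ∷ _ | _    = _ , refl

  -- X starts with c + 1 and contains no c + 2, and Y starts with c + 2.
  castSplit-XY : castSplit (X ++ Y) ≡ length X
  castSplit-XY with X-head
  ... | X′ , X≡ rewrite X≡ = splitIndex-first (suc (suc c)) (suc c) X′ (raise (B* ++ suc c ∷ [])) absent′
    where
    absent : count (suc (suc c)) X ≡ 0
    absent = trans (count-X c) (cong₂ _+_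
      (trans (count-arches-outside (suc c) c D length-D≤ (inj₂ ≤-refl)) (count-concat-absent (suc c) m D D-above c<m))
      (trans (count-arches-outside (suc c) m Bs< length-Bs<≤ (inj₁ (≤-reflexive (sym m∸length-Bs<))))
             (count-concat-absent (suc c) m Bs< Bs<-above c<m)))
    absent′ : count (suc (suc c)) X′ ≡ 0
    absent′ = trans (sym (count-∷-≢ (suc (suc c)) (suc c) X′ (<⇒≢ (n<1+n (suc c)))))
                    (subst (λ z → count (suc (suc c)) z ≡ 0) X≡ absent)

  cast₁-nest : cast 1 (nest (c ∷ r)) ≡ nest (suc c ∷ r)
  cast₁-nest = trans (cong (cast 1) nest-c) (trans (cast₁-swap X Y 1 castSplit-XY) (sym nest-1+c))

  σ₁-nest-≢ : σ 1 (nest (c ∷ r)) ≢ σ 1 (nest (suc c ∷ r))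
  σ₁-nest-≢ = <⇒≢′ (begin-strict
      σ 1 (nest (suc c ∷ r))
    ≡⟨ σ₁-after ⟩
      suc (length (raise A₂)) / 2
    <⟨ m<m+n _ (s≤s z≤n) ⟩
      suc (length (raise A₂)) / 2 + 1
    ≡⟨ sym (half-+-double (suc (length (raise A₂))) 1) ⟩
      (suc (length (raise A₂)) + 2) / 2
    ≤⟨ /-monoˡ-≤ 2 (+-monoʳ-≤ (suc (length (raise A₂))) 2≤length-Y) ⟩
      (suc (length (raise A₂)) + length Y) / 2
    ≡⟨ sym σ₁-before ⟩
      σ 1 (nest (c ∷ r)) ∎)
    where
    open ≤-Reasoning
    <⇒≢′ : ∀ {a b} → b < a → a ≢ b
    <⇒≢′ b<a a≡b = <⇒≢ b<a (sym a≡b)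
    no-1 : ∀ A → count 0 A ≡ 0 → count 1 (raise A) ≡ 0
    no-1 A e = trans (count-raise 0 A) e
    2≤length-Y : 2 ≤ length Y
    2≤length-Y = subst (2 ≤_) (sym (trans (List.length-map suc A*) (List.length-++ (suc c ∷ B*) {suc c ∷ []})))
      (subst (2 ≤_) (sym (+-suc (suc (length B*)) 0)) (s≤s (s≤s z≤n)))
    σ₁-before : σ 1 (nest (c ∷ r)) ≡ (suc (length (raise A₂)) + length Y) / 2
    σ₁-before = begin-equality
        σ 1 (nest (c ∷ r))
      ≡⟨ cong (σ 1) (trans nest-c (trans (List.++-assoc (raise A₁) (1 ∷ raise A₂) (Y ++ 1 ∷ []))
           (cong (λ z → raise A₁ ++ 1 ∷ z) (sym (List.++-assoc (raise A₂) Y (1 ∷ [])))))) ⟩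
        σ 1 (raise A₁ ++ 1 ∷ (raise A₂ ++ Y) ++ 1 ∷ [])
      ≡⟨ σ-between 1 (raise A₁) (raise A₂ ++ Y) (no-1 A₁ count-0-A₁)
           (trans (count-++ 1 (raise A₂) Y) (cong₂ _+_ (no-1 A₂ count-0-A₂) (no-1 A* count-0-A*))) ⟩
        suc (length (raise A₂ ++ Y)) / 2
      ≡⟨ cong (λ z → suc z / 2) (List.length-++ (raise A₂)) ⟩
        (suc (length (raise A₂)) + length Y) / 2 ∎
    σ₁-after : σ 1 (nest (suc c ∷ r)) ≡ suc (length (raise A₂)) / 2
    σ₁-after = trans (cong (σ 1) (trans nest-1+c (trans (cong (Y ++_) (List.++-assoc (raise A₁) (1 ∷ raise A₂) (1 ∷ [])))
           (sym (List.++-assoc Y (raise A₁) (1 ∷ raise A₂ ++ 1 ∷ []))))))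
      (σ-between 1 (Y ++ raise A₁) (raise A₂)
        (trans (count-++ 1 Y (raise A₁)) (cong₂ _+_ (no-1 A* count-0-A*) (no-1 A₁ count-0-A₁))) (no-1 A₂ count-0-A₂))

  -- An entry j ≥ 2 occurs twice in the nest, so by parity it lies either
  -- wholly inside Y or wholly inside X.
  σ-ss-nest : ∀ w → σ (suc (suc w)) (nest (c ∷ r)) ≡ σ (suc (suc w)) (nest (suc c ∷ r))
  σ-ss-nest w = trans (cong (σ (suc (suc w))) nest-c)
    (trans (σ-swap (suc (suc w)) X Y (1 ∷ []) absent) (cong (σ (suc (suc w))) (sym nest-1+c)))
    where
    a = count (suc w) A*
    p = count (suc w) A₂
    q = count (suc w) A₁
    total≤2 : p + (a + q) ≤ 2
    total≤2 = subst (_≤ 2) (begin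
        count (suc w) (nest r)
      ≡⟨ cong (count (suc w)) (trans (cong (arches m) (sym (List.take++drop≡id k (blocks r))))
           (trans (cong (λ z → arches m (Bs< ++ z)) drop-k) (arches-++ m Bs< (B* ∷ D)))) ⟩
        count (suc w) (A₂ ++ arches (m ∸ length Bs<) (B* ∷ D))
      ≡⟨ cong (λ z → count (suc w) (A₂ ++ z))
              (trans (cong (λ z → arches z (B* ∷ D)) m∸length-Bs<) (arches-++ (suc c) (B* ∷ []) D)) ⟩
        count (suc w) (A₂ ++ A* ++ A₁)
      ≡⟨ count-++ (suc w) A₂ _ ⟩
        p + count (suc w) (A* ++ A₁)
      ≡⟨ cong (p +_) (count-++ (suc w) A* A₁) ⟩
        p + (a + q) ∎) (count-nest≤2 (suc w))
      where open ≡-Reasoning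
    absent : (count (suc (suc w)) Y ≡ 0 × count (suc (suc w)) (1 ∷ []) ≡ 0)
           ⊎ (count (suc (suc w)) X ≡ 0 × count (suc (suc w)) (1 ∷ []) ≡ 0)
    absent with even≤2-absorbs {a} {p} {q} (even-count-arches (suc w) (suc c) (B* ∷ [])
                  (All-drop-head k (blocks r) drop-k blocks-even ∷ [])) total≤2
    ... | inj₁ a≡0   = inj₁ (trans (count-raise (suc w) A*) a≡0 , refl)
    ... | inj₂ q+p≡0 = inj₂ (trans (count-X w) q+p≡0 , refl)

-- Enclosing and blowing

enclose : List ℕ → List ℕ
enclose K = 1 ∷ raise K ++ 1 ∷ []

nest-0∷ : ∀ r → nest (0 ∷ r) ≡ enclose (nest r)
nest-0∷ r = trans (nest-∷ 0 r z≤n)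
  (cong₂ (λ Ds Ts → raise (arches 0 Ds) ++ 1 ∷ raise (arches (length (blocks r)) Ts) ++ 1 ∷ [])
         (List.drop-all (length (blocks r)) (blocks r) ≤-refl) (List.take-all (length (blocks r)) (blocks r) ≤-refl))

nest-replicate-0 : ∀ g r → nest (replicate g 0 ++ r) ≡ iter g enclose (nest r)
nest-replicate-0 zero    r = refl
nest-replicate-0 (suc g) r = trans (nest-0∷ (replicate g 0 ++ r)) (cong enclose (nest-replicate-0 g r))

iter-comm : ∀ {A : Set} g (f : A → A) x → iter g f (f x) ≡ f (iter g f x)
iter-comm zero    f x = refl
iter-comm (suc g) f x = cong f (iter-comm g f x)

length-enclose : ∀ K → length (enclose K) ≡ suc (suc (length K))
length-enclose K = cong suc (trans (List.length-++ (raise K)) (trans (+-comm _ 1) (cong suc (List.length-map suc K))))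

≤-length-iter-enclose : ∀ g K → g ≤ length (iter g enclose K)
≤-length-iter-enclose zero    K = z≤n
≤-length-iter-enclose (suc g) K = ≤-trans (s≤s (≤-trans (≤-length-iter-enclose g K) (n≤1+n _)))
  (≤-reflexive (sym (length-enclose (iter g enclose K))))

splitIndex-raise : ∀ v x ys → splitIndex (suc v) (suc x ∷ raise ys) ≡ splitIndex v (x ∷ ys)
splitIndex-raise v x []       = refl
splitIndex-raise v x (y ∷ ys) = cong (λ z → suc (if y ≡ᵇ v then 0 else z)) (splitIndex-raise v x ys)

castSplit-raise : ∀ M → castSplit (raise M) ≡ castSplit M
castSplit-raise []      = refl
castSplit-raise (x ∷ M) = splitIndex-raise (suc x) x M

raise-++⁴ : ∀ W Y X Z → raise (W ++ Y ++ X ++ Z) ≡ raise W ++ raise Y ++ raise X ++ raise Z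
raise-++⁴ W Y X Z = trans (List.map-++ suc W (Y ++ X ++ Z))
  (cong (raise W ++_) (trans (List.map-++ suc Y (X ++ Z)) (cong (raise Y ++_) (List.map-++ suc X Z))))

-- The castling window of enclose K at position g + 2 is the raised window of K
-- at position g + 1, and the raising does not move the split point.
cast-enclose : ∀ g K → g ≤ length K → cast (suc (suc g)) (enclose K) ≡ enclose (cast (suc g) K)
cast-enclose g K g≤ = begin
    cast (suc (suc g)) (enclose K)
  ≡⟨ cast-pieces (suc (suc g)) (enclose K) (1 ∷ raise W) (raise R ++ 1 ∷ []) (raise M) (raise Z ++ 1 ∷ [])
                 W≡ R≡ M≡ Z≡ ⟩
    (1 ∷ raise W) ++ drop (castSplit (raise M)) (raise M) ++ take (castSplit (raise M)) (raise M) ++ raise Z ++ 1 ∷ []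
  ≡⟨ cong (λ i → (1 ∷ raise W) ++ drop i (raise M) ++ take i (raise M) ++ raise Z ++ 1 ∷ []) (castSplit-raise M) ⟩
    1 ∷ raise W ++ drop i (raise M) ++ take i (raise M) ++ raise Z ++ 1 ∷ []
  ≡⟨ cong₂ (λ a b → 1 ∷ raise W ++ a ++ b ++ raise Z ++ 1 ∷ []) (List.drop-map i M) (List.take-map i M) ⟩
    1 ∷ raise W ++ raise (drop i M) ++ raise (take i M) ++ raise Z ++ 1 ∷ []
  ≡⟨ cong (1 ∷_) (sym (trans (cong (_++ 1 ∷ []) (raise-++⁴ W (drop i M) (take i M) Z))
                             (reassoc (raise W) (raise (drop i M)) (raise (take i M)) (raise Z)))) ⟩
    enclose (W ++ drop i M ++ take i M ++ Z)
  ≡⟨ cong enclose (sym (cast-pieces (suc g) K W R M Z refl refl refl refl)) ⟩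
    enclose (cast (suc g) K) ∎
  where
  open ≡-Reasoning
  W = take g K
  R = drop g K
  L = length R ∸ suc g
  M = take L R
  Z = drop L R
  i = castSplit M
  reassoc : ∀ (A B C E : List ℕ) → (A ++ B ++ C ++ E) ++ 1 ∷ [] ≡ A ++ B ++ C ++ E ++ 1 ∷ []
  reassoc A B C E = trans (List.++-assoc A _ _) (cong (A ++_) (trans (List.++-assoc B _ _) (cong (B ++_) (List.++-assoc C E _))))
  g≤′ : g ≤ length (raise K)
  g≤′ = subst (g ≤_) (sym (List.length-map suc K)) g≤
  L≤ : L ≤ length (raise R)
  L≤ = subst (L ≤_) (sym (List.length-map suc R)) (m∸n≤m (length R) (suc g))
  length-R′ : length (raise R ++ 1 ∷ []) ∸ suc (suc g) ≡ L
  length-R′ = cong (_∸ suc (suc g)) (trans (List.length-++ (raise R)) (trans (+-comm _ 1) (cong suc (List.length-map suc R))))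
  W≡ : 1 ∷ raise W ≡ take (suc g) (enclose K)
  W≡ = cong (1 ∷_) (sym (trans (take-++-≤ g (raise K) (1 ∷ []) g≤′) (List.take-map g K)))
  R≡ : raise R ++ 1 ∷ [] ≡ drop (suc g) (enclose K)
  R≡ = sym (trans (drop-++-≤ g (raise K) (1 ∷ []) g≤′) (cong (_++ 1 ∷ []) (List.drop-map g K)))
  M≡ : raise M ≡ take (length (raise R ++ 1 ∷ []) ∸ suc (suc g)) (raise R ++ 1 ∷ [])
  M≡ rewrite length-R′ = sym (trans (take-++-≤ L (raise R) (1 ∷ []) L≤) (List.take-map L R))
  Z≡ : raise Z ++ 1 ∷ [] ≡ drop (length (raise R ++ 1 ∷ []) ∸ suc (suc g)) (raise R ++ 1 ∷ [])
  Z≡ rewrite length-R′ = sym (trans (drop-++-≤ L (raise R) (1 ∷ []) L≤) (cong (_++ 1 ∷ []) (List.drop-map L R)))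

cast-iter-enclose : ∀ g K → cast (suc g) (iter g enclose K) ≡ iter g enclose (cast 1 K)
cast-iter-enclose zero    K = refl
cast-iter-enclose (suc g) K =
  trans (cast-enclose g (iter g enclose K) (≤-length-iter-enclose g K)) (cong enclose (cast-iter-enclose g K))

σ-enclose-ss : ∀ j K → σ (suc (suc j)) (enclose K) ≡ σ (suc j) K
σ-enclose-ss j K = begin
    σ (suc (suc j)) (enclose K)
  ≡⟨ σ-halfGap (suc (suc j)) (enclose K) ⟩
    halfGap (positionsFrom 1 (suc (suc j)) (raise K ++ 1 ∷ []))
  ≡⟨ cong halfGap (trans (positionsFrom-++ 1 (suc (suc j)) (raise K) (1 ∷ []))
       (cong (_++ []) (trans (positionsFrom-raise 1 (suc j) K) (positionsFrom-shift 1 (suc j) K)))) ⟩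
    halfGap (map (1 +_) (positions (suc j) K) ++ [])
  ≡⟨ trans (halfGap-++[] (map (1 +_) (positions (suc j) K))) (halfGap-shift 1 (positions (suc j) K)) ⟩
    halfGap (positions (suc j) K)
  ≡⟨ sym (σ-halfGap (suc j) K) ⟩
    σ (suc j) K ∎
  where open ≡-Reasoning

σ₁-enclose : ∀ K → count 0 K ≡ 0 → σ 1 (enclose K) ≡ suc (length K) / 2
σ₁-enclose K no-0 = trans (σ-between 1 [] (raise K) refl (trans (count-raise 0 K) no-0))
                          (cong (λ z → suc z / 2) (List.length-map suc K))

count-0-iter-enclose : ∀ g K → count 0 K ≡ 0 → count 0 (iter g enclose K) ≡ 0
count-0-iter-enclose zero    K no-0 = no-0
count-0-iter-enclose (suc g) K _    =
  trans (count-++ 0 (raise (iter g enclose K)) (1 ∷ [])) (cong (_+ 0) (count-0-raise (iter g enclose K)))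

length-iter-enclose : ∀ g K K′ → length K ≡ length K′ → length (iter g enclose K) ≡ length (iter g enclose K′)
length-iter-enclose zero    K K′ eq = eq
length-iter-enclose (suc g) K K′ eq = trans (length-enclose (iter g enclose K))
  (trans (cong (λ z → suc (suc z)) (length-iter-enclose g K K′ eq)) (sym (length-enclose (iter g enclose K′))))

σ-iter-enclose-outer : ∀ g j K K′ → 1 ≤ j → j ≤ g →
                       length K ≡ length K′ → count 0 K ≡ 0 → count 0 K′ ≡ 0 →
                       σ j (iter g enclose K) ≡ σ j (iter g enclose K′)
σ-iter-enclose-outer (suc g) (suc zero) K K′ _ _ eq no-0 no-0′ = begin
    σ 1 (enclose (iter g enclose K))
  ≡⟨ σ₁-enclose (iter g enclose K) (count-0-iter-enclose g K no-0) ⟩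
    suc (length (iter g enclose K)) / 2
  ≡⟨ cong (λ z → suc z / 2) (length-iter-enclose g K K′ eq) ⟩
    suc (length (iter g enclose K′)) / 2
  ≡⟨ sym (σ₁-enclose (iter g enclose K′) (count-0-iter-enclose g K′ no-0′)) ⟩
    σ 1 (enclose (iter g enclose K′)) ∎
  where open ≡-Reasoning
σ-iter-enclose-outer (suc g) (suc (suc j)) K K′ _ (s≤s j≤g) eq no-0 no-0′ =
  trans (σ-enclose-ss j (iter g enclose K))
    (trans (σ-iter-enclose-outer g (suc j) K K′ (s≤s z≤n) j≤g eq no-0 no-0′) (sym (σ-enclose-ss j (iter g enclose K′))))

σ-iter-enclose-inner : ∀ g j K → σ (g + suc j) (iter g enclose K) ≡ σ (suc j) K
σ-iter-enclose-inner zero    j K = refl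
σ-iter-enclose-inner (suc g) j K rewrite +-suc g j =
  trans (σ-enclose-ss (g + j) (iter g enclose K))
        (trans (cong (λ z → σ z (iter g enclose K)) (sym (+-suc g j))) (σ-iter-enclose-inner g j K))

σ-iter-enclose-differ-once : ∀ g K K′ → length K ≡ length K′ → count 0 K ≡ 0 → count 0 K′ ≡ 0 →
  (∀ w → σ (suc (suc w)) K ≡ σ (suc (suc w)) K′) → σ 1 K ≢ σ 1 K′ →
  (∀ j → 1 ≤ j → j ≢ suc g → σ j (iter g enclose K) ≡ σ j (iter g enclose K′))
  × σ (suc g) (iter g enclose K) ≢ σ (suc g) (iter g enclose K′)
σ-iter-enclose-differ-once g K K′ eq no-0 no-0′ agree differ = elsewhere , at-1+g
  where
  inner : ∀ j → σ (suc j) K ≡ σ (suc j) K′ → σ (g + suc j) (iter g enclose K) ≡ σ (g + suc j) (iter g enclose K′)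
  inner j same = trans (σ-iter-enclose-inner g j K) (trans same (sym (σ-iter-enclose-inner g j K′)))
  elsewhere : ∀ j → 1 ≤ j → j ≢ suc g → σ j (iter g enclose K) ≡ σ j (iter g enclose K′)
  elsewhere j 1≤j j≢ with ≤-<-connex j g
  ... | inj₁ j≤g = σ-iter-enclose-outer g j K K′ 1≤j j≤g eq no-0 no-0′
  ... | inj₂ g<j = subst (λ z → σ z (iter g enclose K) ≡ σ z (iter g enclose K′)) j≡ (inner (suc w) (agree w))
    where
    2+g≤j : suc (suc g) ≤ j
    2+g≤j with m≤n⇒m<n∨m≡n g<j
    ... | inj₁ lt   = lt
    ... | inj₂ 1+g≡j = ⊥-elim (j≢ (sym 1+g≡j))
    w = j ∸ suc (suc g)
    j≡ : g + suc (suc w) ≡ j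
    j≡ = trans (+-suc g (suc w)) (trans (cong suc (+-suc g w)) (m+[n∸m]≡n 2+g≤j))
  at-1+g : σ (suc g) (iter g enclose K) ≢ σ (suc g) (iter g enclose K′)
  at-1+g same = differ (begin
      σ 1 K
    ≡⟨ sym (σ-iter-enclose-inner g 0 K) ⟩
      σ (g + 1) (iter g enclose K)
    ≡⟨ cong (λ z → σ z (iter g enclose K)) g+1≡ ⟩
      σ (suc g) (iter g enclose K)
    ≡⟨ same ⟩
      σ (suc g) (iter g enclose K′)
    ≡⟨ cong (λ z → σ z (iter g enclose K′)) (sym g+1≡) ⟩
      σ (g + 1) (iter g enclose K′)
    ≡⟨ σ-iter-enclose-inner g 0 K′ ⟩
      σ 1 K′ ∎)
    where
    open ≡-Reasoning
    g+1≡ : g + 1 ≡ suc g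
    g+1≡ = +-comm g 1

insertAfterFirst-++ : ∀ v xs ys → v ∈ xs → insertAfterFirst v (xs ++ ys) ≡ insertAfterFirst v xs ++ ys
insertAfterFirst-++ v (x ∷ xs) ys (here refl) rewrite ≡ᵇ-refl v = refl
insertAfterFirst-++ v (x ∷ xs) ys (there v∈xs) with x ≡ᵇ v
... | true  = refl
... | false = cong (x ∷_) (insertAfterFirst-++ v xs ys v∈xs)

insertAfterFirst-raise : ∀ v xs → insertAfterFirst (suc v) (raise xs) ≡ raise (insertAfterFirst v xs)
insertAfterFirst-raise v []       = refl
insertAfterFirst-raise v (x ∷ xs) with x ≡ᵇ v
... | true  = refl
... | false = cong (suc x ∷_) (insertAfterFirst-raise v xs)

enclosedPair : ℕ → List ℕ
enclosedPair k = iter k enclose (1 ∷ 1 ∷ [])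

∈-enclosedPair : ∀ k → suc k ∈ enclosedPair k
∈-enclosedPair zero    = here refl
∈-enclosedPair (suc k) = there (∈-++⁺ˡ (∈-map⁺ suc (∈-enclosedPair k)))

insertAfterFirst-enclosedPair : ∀ k → insertAfterFirst (suc k) (enclosedPair k) ≡ enclosedPair (suc k)
insertAfterFirst-enclosedPair zero    = refl
insertAfterFirst-enclosedPair (suc k) = cong (1 ∷_)
  (trans (insertAfterFirst-++ (suc (suc k)) (raise (enclosedPair k)) (1 ∷ []) (∈-map⁺ suc (∈-enclosedPair k)))
         (cong (_++ 1 ∷ []) (trans (insertAfterFirst-raise (suc k) (enclosedPair k))
                                   (cong raise (insertAfterFirst-enclosedPair k)))))

length-enclosedPair : ∀ k → length (enclosedPair k) ≡ suc k + suc k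
length-enclosedPair zero    = refl
length-enclosedPair (suc k) = trans (length-enclose (enclosedPair k))
  (cong (λ z → suc (suc z)) (trans (length-enclosedPair k) (sym (+-suc k (suc k)))))

-- Blowing 11 k times encloses it k times: the two central entries k + 1 of
-- the k-fold enclosure are the first entry k + 1.
iter-blow-11 : ∀ k → iter k blow (1 ∷ 1 ∷ []) ≡ enclosedPair k
iter-blow-11 zero    = refl
iter-blow-11 (suc k) rewrite iter-blow-11 k = trans
  (cong (λ z → insertAfterFirst z (enclosedPair k)) (trans (cong (_/ 2) (length-enclosedPair k)) (half-+-double 0 (suc k))))
  (insertAfterFirst-enclosedPair k)

blowTo-length : ∀ k H → length H ≡ k + k → blowTo k H ≡ H
blowTo-length k H len≡ = cong (λ z → iter z blow H)
  (trans (cong (λ z → k ∸ z / 2) len≡) (trans (cong (k ∸_) (half-+-double 0 k)) (n∸n≡0 k)))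

-- Tight strings

Tight : ℕ → List ℕ → Set
Tight p []      = ⊤
Tight p (v ∷ t) = v ≤ suc p × Tight v t

TightRev : ℕ → List ℕ → Set
TightRev p []      = ⊤
TightRev p (c ∷ r) = c ≤ suc (headOr p r) × TightRev p r

TightRev-∷ʳ : ∀ p v r → TightRev v r → v ≤ suc p → TightRev p (r ++ v ∷ [])
TightRev-∷ʳ p v []          _              v≤ = v≤ , tt
TightRev-∷ʳ p v (c ∷ [])    (c≤ , tt)      v≤ = c≤ , v≤ , tt
TightRev-∷ʳ p v (c ∷ x ∷ r) (c≤ , tight)   v≤ = c≤ , TightRev-∷ʳ p v (x ∷ r) tight v≤

Tight⇒TightRev-reverse : ∀ p t → Tight p t → TightRev p (reverse t)
Tight⇒TightRev-reverse p []      _          = tt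
Tight⇒TightRev-reverse p (v ∷ t) (v≤ , tight) = subst (TightRev p) (sym (List.unfold-reverse v t))
  (TightRev-∷ʳ p v (reverse t) (Tight⇒TightRev-reverse v t tight) v≤)

TightRev-replicate-0 : ∀ g r → TightRev 0 r → TightRev 0 (replicate g 0 ++ r)
TightRev-replicate-0 zero    r tight = tight
TightRev-replicate-0 (suc g) r tight = z≤n , TightRev-replicate-0 g r tight

TightRev-drop-0s : ∀ g r → TightRev 0 (replicate g 0 ++ r) → TightRev 0 r
TightRev-drop-0s zero    r tight       = tight
TightRev-drop-0s (suc g) r (_ , tight) = TightRev-drop-0s g r tight

Tight-decrease : ∀ p u c z → Tight p (u ++ suc c ∷ replicate z 0) → Tight p (u ++ c ∷ replicate z 0)
Tight-decrease p []      c z (1+c≤ , _)   = ≤-trans (n≤1+n c) 1+c≤ , zeros c z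
  where
  zeros : ∀ q z → Tight q (replicate z 0)
  zeros q zero    = tt
  zeros q (suc z) = z≤n , zeros 0 z
Tight-decrease p (x ∷ u) c z (x≤ , tight) = x≤ , Tight-decrease x u c z tight

invariant-tight : ∀ r → TightRev 0 r → Invariant r
invariant-tight []      _             = invariant-[]
invariant-tight (c ∷ r) (c≤ , tight) = invariant-∷ c r (invariant-tight r tight) c≤

length-nest-∷ : ∀ c r → c ≤ length (blocks r) → length (nest (c ∷ r)) ≡ suc (suc (length (nest r)))
length-nest-∷ c r c≤ = begin
    length (nest (c ∷ r))
  ≡⟨ cong length (nest-∷ c r c≤) ⟩
    length (raise A₁ ++ 1 ∷ raise A₂ ++ 1 ∷ [])
  ≡⟨ trans (List.length-++ (raise A₁)) (cong₂ (λ a b → a + suc b) (List.length-map suc A₁)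
       (trans (List.length-++ (raise A₂)) (cong (_+ 1) (List.length-map suc A₂)))) ⟩
    length A₁ + suc (length A₂ + 1)
  ≡⟨ cong (length A₁ +_) (cong suc (+-comm (length A₂) 1)) ⟩
    length A₁ + suc (suc (length A₂))
  ≡⟨ trans (+-suc (length A₁) _) (cong suc (trans (+-suc (length A₁) _) (cong suc (+-comm (length A₁) (length A₂))))) ⟩
    suc (suc (length A₂ + length A₁))
  ≡⟨ cong (λ z → suc (suc z)) (sym (trans (cong length (nest-split c r c≤)) (List.length-++ A₂))) ⟩
    suc (suc (length (nest r))) ∎
  where
  open ≡-Reasoning
  A₁ = arches c (drop (length (blocks r) ∸ c) (blocks r))
  A₂ = arches (length (blocks r)) (take (length (blocks r) ∸ c) (blocks r))

length-nest : ∀ r → TightRev 0 r → length (nest r) ≡ suc (length r) + suc (length r)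
length-nest []      _            = refl
length-nest (c ∷ r) (c≤ , tight) =
  trans (length-nest-∷ c r (subst (c ≤_) (sym (Invariant.length-blocks (invariant-tight r tight))) c≤))
        (cong (λ z → suc (suc z)) (trans (length-nest r tight) (sym (+-suc (length r) (suc (length r))))))

<-length-blocks : ∀ {c} r → TightRev 0 r → c ≤ headOr 0 r → suc c ≤ length (blocks r)
<-length-blocks r tight c≤ = subst (_ ≤_) (sym (Invariant.length-blocks (invariant-tight r tight))) (s≤s c≤)

cast-nest : ∀ g c r → TightRev 0 r → c ≤ headOr 0 r →
            cast (suc g) (nest (replicate g 0 ++ c ∷ r)) ≡ nest (replicate g 0 ++ suc c ∷ r)
cast-nest g c r tight c≤ = begin
    cast (suc g) (nest (replicate g 0 ++ c ∷ r))
  ≡⟨ cong (cast (suc g)) (nest-replicate-0 g (c ∷ r)) ⟩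
    cast (suc g) (iter g enclose (nest (c ∷ r)))
  ≡⟨ cast-iter-enclose g (nest (c ∷ r)) ⟩
    iter g enclose (cast 1 (nest (c ∷ r)))
  ≡⟨ cong (iter g enclose) (Castling.cast₁-nest r inv c c<m) ⟩
    iter g enclose (nest (suc c ∷ r))
  ≡⟨ sym (nest-replicate-0 g (suc c ∷ r)) ⟩
    nest (replicate g 0 ++ suc c ∷ r) ∎
  where
  open ≡-Reasoning
  inv = invariant-tight r tight
  c<m = <-length-blocks r tight c≤

σ-nest-differ-once : ∀ g c r → TightRev 0 r → c ≤ headOr 0 r →
  (∀ j → 1 ≤ j → j ≢ suc g → σ j (nest (replicate g 0 ++ c ∷ r)) ≡ σ j (nest (replicate g 0 ++ suc c ∷ r)))
  × σ (suc g) (nest (replicate g 0 ++ c ∷ r)) ≢ σ (suc g) (nest (replicate g 0 ++ suc c ∷ r))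
σ-nest-differ-once g c r tight c≤ rewrite nest-replicate-0 g (c ∷ r) | nest-replicate-0 g (suc c ∷ r) =
  σ-iter-enclose-differ-once g (nest (c ∷ r)) (nest (suc c ∷ r))
    (trans (length-nest-∷ c r (<⇒≤ c<m)) (sym (length-nest-∷ (suc c) r c<m)))
    (count-0-nest (c ∷ r) (invariant-∷ c r inv (m≤n⇒m≤1+n c≤)))
    (count-0-nest (suc c ∷ r) (invariant-∷ (suc c) r inv (s≤s c≤)))
    (Castling.σ-ss-nest r inv c c<m)
    (Castling.σ₁-nest-≢ r inv c c<m)
  where
  inv = invariant-tight r tight
  c<m = <-length-blocks r tight c≤

blowTo-root : ∀ g → blowTo (suc g + 1) (1 ∷ 1 ∷ []) ≡ nest (replicate g 0 ++ 0 ∷ [])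
blowTo-root g = begin
    iter (suc g + 1 ∸ 1) blow (1 ∷ 1 ∷ [])
  ≡⟨ cong (λ z → iter z blow (1 ∷ 1 ∷ [])) (m+n∸n≡m (suc g) 1) ⟩
    iter (suc g) blow (1 ∷ 1 ∷ [])
  ≡⟨ iter-blow-11 (suc g) ⟩
    enclose (iter g enclose (1 ∷ 1 ∷ []))
  ≡⟨ sym (iter-comm g enclose (1 ∷ 1 ∷ [])) ⟩
    iter g enclose (nest (0 ∷ []))
  ≡⟨ sym (nest-replicate-0 g (0 ∷ [])) ⟩
    nest (replicate g 0 ++ 0 ∷ []) ∎
  where open ≡-Reasoning

-- The enumeration b

Lex : List ℕ → List ℕ → Set
Lex []       _        = ⊥
Lex (x ∷ xs) []       = ⊥
Lex (x ∷ xs) (y ∷ ys) = x < y ⊎ (x ≡ y × Lex xs ys)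

Lex-asym : ∀ xs ys → Lex xs ys → Lex ys xs → ⊥
Lex-asym (x ∷ xs) (y ∷ ys) (inj₁ x<y)          (inj₁ y<x)          = <-asym x<y y<x
Lex-asym (x ∷ xs) (y ∷ ys) (inj₁ x<y)          (inj₂ (refl , _))   = <-irrefl refl x<y
Lex-asym (x ∷ xs) (y ∷ ys) (inj₂ (refl , _))   (inj₁ y<x)          = <-irrefl refl y<x
Lex-asym (x ∷ xs) (y ∷ ys) (inj₂ (_ , xs<ys)) (inj₂ (_ , ys<xs)) = Lex-asym xs ys xs<ys ys<xs

Lex-irrefl : ∀ xs → Lex xs xs → ⊥
Lex-irrefl xs xs<xs = Lex-asym xs xs xs<xs xs<xs

Lex-∷-< : ∀ u c z → Lex (u ++ c ∷ z) (u ++ suc c ∷ z)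
Lex-∷-< []      c z = inj₁ (n<1+n c)
Lex-∷-< (x ∷ u) c z = inj₂ (refl , Lex-∷-< u c z)

Shortlex : List ℕ → List ℕ → Set
Shortlex x y = length x < length y ⊎ (length x ≡ length y × Lex x y)

Shortlex-asym : ∀ x y → Shortlex x y → Shortlex y x → ⊥
Shortlex-asym x y (inj₁ x<y)       (inj₁ y<x)       = <-asym x<y y<x
Shortlex-asym x y (inj₁ x<y)       (inj₂ (y≡x , _)) = <-irrefl (sym y≡x) x<y
Shortlex-asym x y (inj₂ (x≡y , _)) (inj₁ y<x)       = <-irrefl (sym x≡y) y<x
Shortlex-asym x y (inj₂ (_ , x<y)) (inj₂ (_ , y<x)) = Lex-asym x y x<y y<x

NonzeroTRGS : List ℕ → Set
NonzeroTRGS s = ∃ λ t → s ≡ 1 ∷ t × Tight 1 t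

trgs⁺ : ℕ → List (List ℕ)
trgs⁺ zero    = (1 ∷ []) ∷ []
trgs⁺ (suc k) = trgs⁺ k ++ trgs (suc (suc k))

trgsUpTo-trgs⁺ : ∀ k → trgsUpTo (suc k) ≡ (0 ∷ []) ∷ trgs⁺ k
trgsUpTo-trgs⁺ zero    = refl
trgsUpTo-trgs⁺ (suc k) = cong (_++ trgs (suc (suc k))) (trgsUpTo-trgs⁺ k)

b-suc : ∀ n → b (suc n) ≡ nth n (trgs⁺ (suc n)) []
b-suc n = cong (λ ss → nth (suc n) ss []) (trgsUpTo-trgs⁺ (suc n))

ext-tight : ∀ p m → All (λ t → Tight p t × length t ≡ m) (ext p m)
ext-tight p zero    = (tt , refl) ∷ []
ext-tight p (suc m) = All.concat⁺ (All.map⁺ (All.tabulate (λ {v} v∈ →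
  All.map⁺ (All.map (λ (tight , len≡) → (s≤s⁻¹ (∈-upTo⁻ v∈) , tight) , cong suc len≡) (ext-tight v m)))))

ext-nonempty : ∀ p m → 1 ≤ length (ext p m)
ext-nonempty p zero    = s≤s z≤n
ext-nonempty p (suc m) = ≤-trans (ext-nonempty 0 m)
  (≤-trans (≤-reflexive (sym (List.length-map (0 ∷_) (ext 0 m)))) (List.length-++-≤ˡ (map (0 ∷_) (ext 0 m))))

ext-complete : ∀ p t → Tight p t → t ∈ ext p (length t)
ext-complete p []      _            = here refl
ext-complete p (v ∷ t) (v≤ , tight) = ∈-concat⁺′ (∈-map⁺ (v ∷_) (ext-complete v t tight))
  (∈-map⁺ (λ w → map (w ∷_) (ext w (length t))) (∈-upTo⁺ (s≤s v≤)))

All-map-∷ : ∀ {P : List ℕ → Set} v (xs : List (List ℕ)) → (∀ t → P (v ∷ t)) → All P (map (v ∷_) xs)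
All-map-∷ v []       f = []
All-map-∷ v (x ∷ xs) f = f x ∷ All-map-∷ v xs f

ext-sorted : ∀ p m → AllPairs Lex (ext p m)
ext-sorted p zero    = [] ∷ []
ext-sorted p (suc m) = AllPairs.concat⁺
  (All.map⁺ (All.tabulate (λ {v} _ → AllPairs.map⁺ (AllPairs.map (λ xs<ys → inj₂ (refl , xs<ys)) (ext-sorted v m)))))
  (AllPairs.map⁺ (AllPairs.applyUpTo⁺₁ id (suc (suc p)) (λ {i} {j} i<j _ →
    All-map-∷ i (ext i m) (λ _ → All-map-∷ j (ext j m) (λ _ → inj₁ i<j)))))

AllPairs-strengthen : ∀ {P : List ℕ → Set} {R S : List ℕ → List ℕ → Set} xs → All P xs → AllPairs R xs →
                      (∀ {x y} → P x → P y → R x y → S x y) → AllPairs S xs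
AllPairs-strengthen []       _          _          f = []
AllPairs-strengthen (x ∷ xs) (px ∷ pxs) (rx ∷ rxs) f =
  All.zipWith (λ (py , r) → f px py r) (pxs , rx) ∷ AllPairs-strengthen xs pxs rxs f

trgs⁺-sound : ∀ k → All (λ s → NonzeroTRGS s × length s ≤ suc k) (trgs⁺ k)
trgs⁺-sound zero    = (([] , refl , tt) , s≤s z≤n) ∷ []
trgs⁺-sound (suc k) = All.++⁺ (All.map (λ (trgs , len≤) → trgs , m≤n⇒m≤1+n len≤) (trgs⁺-sound k))
  (All.map⁺ (All.map (λ {t} (tight , len≡) → (t , refl , tight) , ≤-reflexive (cong suc len≡)) (ext-tight 1 (suc k))))

trgs⁺-length : ∀ k → suc k ≤ length (trgs⁺ k)
trgs⁺-length zero    = ≤-refl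
trgs⁺-length (suc k) = subst (_≤ length (trgs⁺ (suc k))) (+-comm (suc k) 1)
  (subst (suc k + 1 ≤_) (sym (List.length-++ (trgs⁺ k)))
    (+-mono-≤ (trgs⁺-length k) (subst (1 ≤_) (sym (List.length-map (1 ∷_) (ext 1 (suc k)))) (ext-nonempty 1 (suc k)))))

trgs⁺-prefix : ∀ j k → j ≤ k → ∃ λ rest → trgs⁺ k ≡ trgs⁺ j ++ rest
trgs⁺-prefix j k j≤k = subst (λ z → ∃ λ rest → trgs⁺ z ≡ trgs⁺ j ++ rest) (m∸n+n≡m j≤k) (prefix (k ∸ j))
  where
  prefix : ∀ d → ∃ λ rest → trgs⁺ (d + j) ≡ trgs⁺ j ++ rest
  prefix zero    = [] , sym (List.++-identityʳ (trgs⁺ j))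
  prefix (suc d) with prefix d
  ... | rest , eq = rest ++ trgs (suc (suc (d + j))) ,
    trans (cong (_++ trgs (suc (suc (d + j)))) eq) (List.++-assoc (trgs⁺ j) rest _)

trgs⁺-complete : ∀ k t → Tight 1 t → length (1 ∷ t) ≤ suc k → (1 ∷ t) ∈ trgs⁺ k
trgs⁺-complete k [] _ _ with trgs⁺-prefix 0 k z≤n
... | rest , eq = subst ((1 ∷ []) ∈_) (sym eq) (here refl)
trgs⁺-complete k (x ∷ t) tight (s≤s len≤) with trgs⁺-prefix (suc (length t)) k len≤
... | rest , eq = subst ((1 ∷ x ∷ t) ∈_) (sym eq)
  (∈-++⁺ˡ (∈-++⁺ʳ (trgs⁺ (length t)) (∈-map⁺ (1 ∷_) (ext-complete 1 (x ∷ t) tight))))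

trgs⁺-sorted : ∀ k → AllPairs Shortlex (trgs⁺ k)
trgs⁺-sorted zero    = [] ∷ []
trgs⁺-sorted (suc k) = AllPairs.++⁺ (trgs⁺-sorted k)
  (AllPairs.map⁺ (AllPairs-strengthen (ext 1 (suc k)) (ext-tight 1 (suc k)) (ext-sorted 1 (suc k))
     (λ (_ , len≡) (_ , len≡′) xs<ys → inj₂ (cong suc (trans len≡ (sym len≡′)) , inj₂ (refl , xs<ys)))))
  (All.map (λ (_ , len≤) → All.map⁺ (All.map (λ (_ , len≡) → inj₁ (s≤s (≤-trans len≤ (≤-reflexive (sym len≡)))))
                                              (ext-tight 1 (suc k))))
           (trgs⁺-sound k))

nth-∈ : ∀ i (xs : List (List ℕ)) d → i < length xs → nth i xs d ∈ xs
nth-∈ zero    (x ∷ xs) d _        = here refl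
nth-∈ (suc i) (x ∷ xs) d (s≤s i<) = there (nth-∈ i xs d i<)

∈⇒nth : ∀ {x : List ℕ} xs d → x ∈ xs → ∃ λ i → i < length xs × nth i xs d ≡ x
∈⇒nth (y ∷ xs) d (here refl) = 0 , s≤s z≤n , refl
∈⇒nth (y ∷ xs) d (there x∈) with ∈⇒nth xs d x∈
... | i , i< , nth≡ = suc i , s≤s i< , nth≡

nth-++ˡ : ∀ i (xs ys : List (List ℕ)) d → i < length xs → nth i (xs ++ ys) d ≡ nth i xs d
nth-++ˡ zero    (x ∷ xs) ys d _        = refl
nth-++ˡ (suc i) (x ∷ xs) ys d (s≤s i<) = nth-++ˡ i xs ys d i<

AllPairs-nth : ∀ {R : List ℕ → List ℕ → Set} xs d i j → AllPairs R xs → i < j → j < length xs →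
               R (nth i xs d) (nth j xs d)
AllPairs-nth (x ∷ xs) d zero    (suc j) (px ∷ _)   _        (s≤s j<) = All.lookup px (nth-∈ j xs d j<)
AllPairs-nth (x ∷ xs) d (suc i) (suc j) (_ ∷ pxs) (s≤s i<j) (s≤s j<) = AllPairs-nth xs d i j pxs i<j j<

b-nonzero : ∀ n → NonzeroTRGS (b (suc n)) × length (b (suc n)) ≤ suc (suc n)
b-nonzero n rewrite b-suc n =
  All.lookup (trgs⁺-sound (suc n)) (nth-∈ n (trgs⁺ (suc n)) [] (≤-trans (n≤1+n (suc n)) (trgs⁺-length (suc n))))

-- Sortedness of trgs⁺ (1 + n) places such an s before b (1 + n).
b-smaller : ∀ n s → NonzeroTRGS s → length s ≡ length (b (suc n)) → Lex s (b (suc n)) →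
            ∃ λ m → m < suc n × b m ≡ s
b-smaller n s (t , refl , tight) len≡ s<b
  with ∈⇒nth (trgs⁺ (suc n)) [] (trgs⁺-complete (suc n) t tight (≤-trans (≤-reflexive len≡) (proj₂ (b-nonzero n))))
... | i , i< , nth≡ = suc i , s≤s i<n , (begin
      b (suc i)
    ≡⟨ b-suc i ⟩
      nth i (trgs⁺ (suc i)) []
    ≡⟨ sym (nth-++ˡ i (trgs⁺ (suc i)) rest [] (≤-trans (n≤1+n (suc i)) (trgs⁺-length (suc i)))) ⟩
      nth i (trgs⁺ (suc i) ++ rest) []
    ≡⟨ cong (λ ss → nth i ss []) (sym prefix≡) ⟩
      nth i (trgs⁺ (suc n)) []
    ≡⟨ nth≡ ⟩
      s ∎)
  where
  open ≡-Reasoning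
  i<n : i < n
  i<n with <-cmp i n
  ... | tri< i<n _ _ = i<n
  ... | tri≈ _ refl _ = ⊥-elim (Lex-irrefl s (subst (Lex s) (trans (b-suc n) nth≡) s<b))
  ... | tri> _ _ n<i = ⊥-elim (Shortlex-asym s (b (suc n)) (inj₂ (len≡ , s<b))
          (subst₂ Shortlex (sym (b-suc n)) nth≡ (AllPairs-nth (trgs⁺ (suc n)) [] n i (trgs⁺-sorted (suc n)) n<i i<)))
  rest = proj₁ (trgs⁺-prefix (suc i) (suc n) (s≤s (<⇒≤ i<n)))
  prefix≡ : trgs⁺ (suc n) ≡ trgs⁺ (suc i) ++ rest
  prefix≡ = proj₂ (trgs⁺-prefix (suc i) (suc n) (s≤s (<⇒≤ i<n)))

eqList-sound : ∀ xs ys → eqList xs ys ≡ true → xs ≡ ys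
eqList-sound []       []       _ = refl
eqList-sound (x ∷ xs) (y ∷ ys) e with x ≡ᵇ y in x≡ᵇy
... | true = cong₂ _∷_ (≡ᵇ-true⇒≡ x y x≡ᵇy) (eqList-sound xs ys e)

eqList-refl : ∀ xs → eqList xs xs ≡ true
eqList-refl []       = refl
eqList-refl (x ∷ xs) rewrite ≡ᵇ-refl x = eqList-refl xs

searchIndex-found : ∀ s ms m → m ∈ ms → b m ≡ s → searchIndex s ms ∈ ms × b (searchIndex s ms) ≡ s
searchIndex-found s (m′ ∷ ms) m m∈ bm≡s with eqList (b m′) s in test
... | true  = here refl , eqList-sound (b m′) s test
... | false with m∈
...   | here refl = ⊥-elim (false≢true (trans (sym test) (subst (λ z → eqList (b m) z ≡ true) bm≡s (eqList-refl (b m)))))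
  where
  false≢true : false ≢ true
  false≢true ()
...   | there m∈ms = map₁ there (searchIndex-found s ms m m∈ms bm≡s)

-- Parents and the closed form of F

record LowestNonzero (r : List ℕ) : Set where
  field
    g c            : ℕ
    rest           : List ℕ
    firstNonzero≡  : firstNonzero r ≡ suc g
    r≡             : r ≡ replicate g 0 ++ suc c ∷ rest
    decAt≡         : decAt (suc g) r ≡ replicate g 0 ++ c ∷ rest

lowestNonzero : ∀ r k → LowestNonzero (r ++ suc k ∷ [])
lowestNonzero []          k = record { g = 0 ; c = k ; rest = [] ; firstNonzero≡ = refl ; r≡ = refl ; decAt≡ = refl }
lowestNonzero (suc x ∷ r) k =
  record { g = 0 ; c = x ; rest = r ++ suc k ∷ [] ; firstNonzero≡ = refl ; r≡ = refl ; decAt≡ = refl }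
lowestNonzero (zero ∷ r)  k = record
  { g = suc g ; c = c ; rest = rest
  ; firstNonzero≡ = cong suc firstNonzero≡ ; r≡ = cong (0 ∷_) r≡ ; decAt≡ = cong (0 ∷_) decAt≡ }
  where open LowestNonzero (lowestNonzero r k)

reverse-replicate : ∀ g (x : ℕ) → reverse (replicate g x) ≡ replicate g x
reverse-replicate zero    x = refl
reverse-replicate (suc g) x = trans (List.unfold-reverse x (replicate g x))
  (trans (cong (_++ x ∷ []) (reverse-replicate g x)) (replicate-∷ʳ g))
  where
  replicate-∷ʳ : ∀ g → replicate g x ++ x ∷ [] ≡ x ∷ replicate g x
  replicate-∷ʳ zero    = refl
  replicate-∷ʳ (suc g) = cong (x ∷_) (replicate-∷ʳ g)

reverse-0s-∷ : ∀ g x r → reverse (replicate g 0 ++ x ∷ r) ≡ reverse r ++ x ∷ replicate g 0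
reverse-0s-∷ g x r = trans (List.reverse-++ (replicate g 0) (x ∷ r))
  (trans (cong₂ _++_ (List.unfold-reverse x r) (reverse-replicate g 0)) (List.++-assoc (reverse r) (x ∷ []) (replicate g 0)))

reverse-∷ : ∀ (x : ℕ) xs → ∃ λ y → ∃ λ u → reverse (x ∷ xs) ≡ y ∷ u
reverse-∷ x xs with reverse xs | List.unfold-reverse x xs
... | []     | eq = x , [] , eq
... | z ∷ zs | eq = z , zs ++ x ∷ [] , eq

-- b n read from the right, as 0^g (c + 1) r, together with what ρ n is.
record ParentShape (n : ℕ) : Set where
  field
    g c    : ℕ
    r      : List ℕ
    γ≡     : γ n ≡ suc g
    ℓ≡     : ℓ n ≡ g + suc (length r)
    tight  : TightRev 0 r
    c≤     : c ≤ headOr 0 r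
    b≡     : reverse (b n) ≡ replicate g 0 ++ suc c ∷ r
    parent : (ρ n ≡ 0 × r ≡ []) ⊎ (1 ≤ ρ n × ρ n < n × reverse (b (ρ n)) ≡ replicate g 0 ++ c ∷ r)

ρ-root : ∀ n → γ n ≡ ℓ n → ρ n ≡ 0
ρ-root n γ≡ℓ rewrite γ≡ℓ | ≡ᵇ-refl (ℓ n) = refl

ρ-search : ∀ n → γ n ≢ ℓ n → ρ n ≡ searchIndex (reverse (decAt (γ n) (reverse (b n)))) (upTo n)
ρ-search n γ≢ℓ rewrite ≢⇒≡ᵇ-false (γ n) (ℓ n) γ≢ℓ = refl

b-index-nonzero : ∀ m g c x r → reverse (b m) ≡ replicate g 0 ++ c ∷ x ∷ r → 1 ≤ m
b-index-nonzero (suc m) _             _ _ _ _  = s≤s z≤n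
b-index-nonzero zero    zero          _ _ _ ()
b-index-nonzero zero    (suc zero)    _ _ _ ()
b-index-nonzero zero    (suc (suc _)) _ _ _ ()

ℓ-shape : ∀ n g x r → reverse (b n) ≡ replicate g 0 ++ x ∷ r → ℓ n ≡ g + suc (length r)
ℓ-shape n g x r b≡ = trans (sym (List.length-reverse (b n))) (trans (cong length b≡)
  (trans (List.length-++ (replicate g 0)) (cong (_+ suc (length r)) (List.length-replicate g))))

-- Lowering a_γ gives a lexicographically smaller nonzero TRGS of the same
-- length.
lowered-earlier : ∀ n g c x r → reverse (b (suc n)) ≡ replicate g 0 ++ suc c ∷ x ∷ r →
                  ∃ λ m → m < suc n × b m ≡ reverse (replicate g 0 ++ c ∷ x ∷ r)
lowered-earlier n g c x r b≡ = b-smaller n s nonzero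
  (trans (cong length s≡) (trans (length-mid front) (cong length (sym bn≡))))
  (subst₂ Lex (sym s≡) (sym bn≡) (Lex-∷-< front c (replicate g 0)))
  where
  s = reverse (replicate g 0 ++ c ∷ x ∷ r)
  front = reverse (x ∷ r)
  s≡ : s ≡ front ++ c ∷ replicate g 0
  s≡ = reverse-0s-∷ g c (x ∷ r)
  bn≡ : b (suc n) ≡ front ++ suc c ∷ replicate g 0
  bn≡ = trans (sym (List.reverse-involutive (b (suc n)))) (trans (cong reverse b≡) (reverse-0s-∷ g (suc c) (x ∷ r)))
  length-mid : ∀ (A : List ℕ) → length (A ++ c ∷ replicate g 0) ≡ length (A ++ suc c ∷ replicate g 0)
  length-mid []      = refl
  length-mid (a ∷ A) = cong suc (length-mid A)
  nonzero : NonzeroTRGS s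
  nonzero with reverse-∷ x r | proj₁ (b-nonzero n)
  ... | y , u , front≡ | t , b≡1∷t , tight = u ++ c ∷ replicate g 0 , s≡′ ,
      Tight-decrease 1 u c g (subst (Tight 1) (List.∷-injectiveʳ 1∷t≡) tight)
    where
    1∷t≡ : 1 ∷ t ≡ y ∷ u ++ suc c ∷ replicate g 0
    1∷t≡ = trans (sym b≡1∷t) (trans bn≡ (cong (_++ suc c ∷ replicate g 0) front≡))
    s≡′ : s ≡ 1 ∷ u ++ c ∷ replicate g 0
    s≡′ = trans s≡ (trans (cong (_++ c ∷ replicate g 0) front≡)
                          (cong (λ z → z ∷ u ++ c ∷ replicate g 0) (sym (List.∷-injectiveˡ 1∷t≡))))

ρ-found : ∀ n g c x r → γ (suc n) ≡ suc g → reverse (b (suc n)) ≡ replicate g 0 ++ suc c ∷ x ∷ r →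
          decAt (γ (suc n)) (reverse (b (suc n))) ≡ replicate g 0 ++ c ∷ x ∷ r →
          1 ≤ ρ (suc n) × ρ (suc n) < suc n × reverse (b (ρ (suc n))) ≡ replicate g 0 ++ c ∷ x ∷ r
ρ-found n g c x r γ≡ b≡ decAt≡ =
  b-index-nonzero (ρ (suc n)) g c x r parent≡ , subst (_< suc n) (sym ρ≡) (∈-upTo⁻ (proj₁ found)) , parent≡
  where
  open ≡-Reasoning
  s = reverse (decAt (γ (suc n)) (reverse (b (suc n))))
  γ≢ℓ : γ (suc n) ≢ ℓ (suc n)
  γ≢ℓ γ≡ℓ = m+1+n≢m (suc g) (sym (trans (sym γ≡) (trans γ≡ℓ
    (trans (ℓ-shape (suc n) g (suc c) (x ∷ r) b≡) (+-suc g (suc (length r)))))))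
  ρ≡ : ρ (suc n) ≡ searchIndex s (upTo (suc n))
  ρ≡ = ρ-search (suc n) γ≢ℓ
  earlier = lowered-earlier n g c x r b≡
  found : searchIndex s (upTo (suc n)) ∈ upTo (suc n) × b (searchIndex s (upTo (suc n))) ≡ s
  found = searchIndex-found s (upTo (suc n)) (proj₁ earlier) (∈-upTo⁺ (proj₁ (proj₂ earlier)))
    (trans (proj₂ (proj₂ earlier)) (cong reverse (sym decAt≡)))
  parent≡ : reverse (b (ρ (suc n))) ≡ replicate g 0 ++ c ∷ x ∷ r
  parent≡ = begin
      reverse (b (ρ (suc n)))
    ≡⟨ cong (λ m → reverse (b m)) ρ≡ ⟩
      reverse (b (searchIndex s (upTo (suc n))))
    ≡⟨ cong reverse (proj₂ found) ⟩
      reverse (reverse (decAt (γ (suc n)) (reverse (b (suc n)))))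
    ≡⟨ List.reverse-involutive _ ⟩
      decAt (γ (suc n)) (reverse (b (suc n)))
    ≡⟨ decAt≡ ⟩
      replicate g 0 ++ c ∷ x ∷ r ∎

parentShape : ∀ n → ParentShape (suc n)
parentShape n = shape rest r≡ decAt≡′ tight c≤
  where
  t = proj₁ (proj₁ (b-nonzero n))
  b≡1∷t : b (suc n) ≡ 1 ∷ t
  b≡1∷t = proj₁ (proj₂ (proj₁ (b-nonzero n)))
  lowest : LowestNonzero (reverse (b (suc n)))
  lowest = subst LowestNonzero (sym (trans (cong reverse b≡1∷t) (List.unfold-reverse 1 t))) (lowestNonzero (reverse t) 0)
  open LowestNonzero lowest
  γ≡ : γ (suc n) ≡ suc g
  γ≡ = firstNonzero≡
  decAt≡′ : decAt (γ (suc n)) (reverse (b (suc n))) ≡ replicate g 0 ++ c ∷ rest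
  decAt≡′ = trans (cong (λ i → decAt i (reverse (b (suc n)))) γ≡) decAt≡
  tight-b : TightRev 0 (replicate g 0 ++ suc c ∷ rest)
  tight-b = subst (TightRev 0) r≡ (Tight⇒TightRev-reverse 0 (b (suc n))
              (subst (Tight 0) (sym b≡1∷t) (≤-refl , proj₂ (proj₂ (proj₁ (b-nonzero n))))))
  tight : TightRev 0 rest
  tight = proj₂ (TightRev-drop-0s g _ tight-b)
  c≤ : c ≤ headOr 0 rest
  c≤ = s≤s⁻¹ (proj₁ (TightRev-drop-0s g _ tight-b))
  shape : ∀ r → reverse (b (suc n)) ≡ replicate g 0 ++ suc c ∷ r →
          decAt (γ (suc n)) (reverse (b (suc n))) ≡ replicate g 0 ++ c ∷ r →
          TightRev 0 r → c ≤ headOr 0 r → ParentShape (suc n)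
  shape []      b≡ _      tight c≤ = record
    { g = g ; c = c ; r = [] ; γ≡ = γ≡ ; ℓ≡ = ℓ-shape (suc n) g (suc c) [] b≡ ; tight = tight ; c≤ = c≤ ; b≡ = b≡
    ; parent = inj₁ (ρ-root (suc n) (trans γ≡ (sym (trans (ℓ-shape (suc n) g (suc c) [] b≡) (+-comm g 1)))) , refl) }
  shape (x ∷ r) b≡ decAt≡ tight c≤ = record
    { g = g ; c = c ; r = x ∷ r ; γ≡ = γ≡ ; ℓ≡ = ℓ-shape (suc n) g (suc c) (x ∷ r) b≡ ; tight = tight ; c≤ = c≤ ; b≡ = b≡
    ; parent = inj₂ (ρ-found n g c x r γ≡ b≡ decAt≡) }

Ffuel-0 : ∀ f → Ffuel f 0 ≡ 1 ∷ 1 ∷ []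
Ffuel-0 zero    = refl
Ffuel-0 (suc f) = refl

module _ (n : ℕ) (P : ParentShape n) where
  open ParentShape P

  blown-parent : ∀ f → (∀ m → m < f → 1 ≤ m → Ffuel f m ≡ nest (reverse (b m))) → ρ n < f →
                 blowTo (ℓ n + 1) (Ffuel f (ρ n)) ≡ nest (replicate g 0 ++ c ∷ r)
  blown-parent f IH ρ<f with parent
  ... | inj₁ (ρ≡0 , r≡[]) = begin
      blowTo (ℓ n + 1) (Ffuel f (ρ n))
    ≡⟨ cong₂ (λ l H → blowTo (l + 1) H) ℓ≡1+g (trans (cong (Ffuel f) ρ≡0) (Ffuel-0 f)) ⟩
      blowTo (suc g + 1) (1 ∷ 1 ∷ [])
    ≡⟨ blowTo-root g ⟩
      nest (replicate g 0 ++ 0 ∷ [])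
    ≡⟨ cong (λ z → nest (replicate g 0 ++ z))
            (sym (cong₂ _∷_ (n≤0⇒n≡0 (subst (λ z → c ≤ headOr 0 z) r≡[] c≤)) r≡[])) ⟩
      nest (replicate g 0 ++ c ∷ r) ∎
    where
    open ≡-Reasoning
    ℓ≡1+g : ℓ n ≡ suc g
    ℓ≡1+g = trans ℓ≡ (trans (cong (λ z → g + suc (length z)) r≡[]) (+-comm g 1))
  ... | inj₂ (1≤ρ , _ , parent≡) = begin
      blowTo (ℓ n + 1) (Ffuel f (ρ n))
    ≡⟨ cong (blowTo (ℓ n + 1)) (trans (IH (ρ n) ρ<f 1≤ρ) (cong nest parent≡)) ⟩
      blowTo (ℓ n + 1) (nest (replicate g 0 ++ c ∷ r))
    ≡⟨ blowTo-length (ℓ n + 1) _ (trans (length-nest _ tight′) (cong (λ z → z + z) length≡)) ⟩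
      nest (replicate g 0 ++ c ∷ r) ∎
    where
    open ≡-Reasoning
    tight′ : TightRev 0 (replicate g 0 ++ c ∷ r)
    tight′ = TightRev-replicate-0 g (c ∷ r) (≤-trans c≤ (n≤1+n _) , tight)
    length≡ : suc (length (replicate g 0 ++ c ∷ r)) ≡ ℓ n + 1
    length≡ = trans (cong suc (trans (List.length-++ (replicate g 0)) (cong (_+ suc (length r)) (List.length-replicate g))))
                    (trans (cong suc (sym ℓ≡)) (+-comm 1 (ℓ n)))

Ffuel-nest : ∀ f n → n < f → 1 ≤ n → Ffuel f n ≡ nest (reverse (b n))
Ffuel-nest (suc f) (suc n) (s≤s n<f) _ = begin
    cast (γ (suc n)) (blowTo (ℓ (suc n) + 1) (Ffuel f (ρ (suc n))))
  ≡⟨ cong₂ cast γ≡ (blown-parent (suc n) P f (Ffuel-nest f) (<-≤-trans ρ< n<f)) ⟩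
    cast (suc g) (nest (replicate g 0 ++ c ∷ r))
  ≡⟨ cast-nest g c r tight c≤ ⟩
    nest (replicate g 0 ++ suc c ∷ r)
  ≡⟨ cong nest (sym b≡) ⟩
    nest (reverse (b (suc n))) ∎
  where
  open ≡-Reasoning
  P = parentShape n
  open ParentShape P
  ρ< : ρ (suc n) < suc n
  ρ< with parent
  ... | inj₁ (ρ≡0 , _)    = subst (_< suc n) (sym ρ≡0) (s≤s z≤n)
  ... | inj₂ (_ , ρ< , _) = ρ<

theorem39 : (n : ℕ) → 1 ≤ n →
    (∀ j → 1 ≤ j → j ≤ (ℓ n + 1) ∸ 1 → j ≢ γ n →
      σ j (blowTo (ℓ n + 1) (F (ρ n))) ≡ σ j (F n))
    × σ (γ n) (blowTo (ℓ n + 1) (F (ρ n))) ≢ σ (γ n) (F n)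
theorem39 (suc n) _ = elsewhere , at-γ
  where
  P = parentShape n
  open ParentShape P
  G≡ : blowTo (ℓ (suc n) + 1) (F (ρ (suc n))) ≡ nest (replicate g 0 ++ c ∷ r)
  G≡ = blown-parent (suc n) P (suc (ρ (suc n))) (Ffuel-nest (suc (ρ (suc n)))) ≤-refl
  F≡ : F (suc n) ≡ nest (replicate g 0 ++ suc c ∷ r)
  F≡ = trans (Ffuel-nest (suc (suc n)) (suc n) ≤-refl (s≤s z≤n)) (cong nest b≡)
  differ = σ-nest-differ-once g c r tight c≤
  elsewhere : ∀ j → 1 ≤ j → j ≤ (ℓ (suc n) + 1) ∸ 1 → j ≢ γ (suc n) →
              σ j (blowTo (ℓ (suc n) + 1) (F (ρ (suc n)))) ≡ σ j (F (suc n))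
  elsewhere j 1≤j _ j≢γ = subst₂ (λ G H → σ j G ≡ σ j H) (sym G≡) (sym F≡)
    (proj₁ differ j 1≤j (λ j≡ → j≢γ (trans j≡ (sym γ≡))))
  at-γ : σ (γ (suc n)) (blowTo (ℓ (suc n) + 1) (F (ρ (suc n)))) ≢ σ (γ (suc n)) (F (suc n))
  at-γ same = proj₂ differ (subst₂ (λ i G → σ i G ≡ σ i (nest (replicate g 0 ++ suc c ∷ r))) γ≡ G≡
    (trans same (cong (σ (γ (suc n))) F≡)))
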